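{- For any integers $1\le k\le n$, \[ |\{\pi \in \S_n(321) \,:\, \mathrm{bl}(\pi) = k\}| = |\{\pi \in \S_n(321) \,:\, \mathrm{ldes}(\pi^{ -1}) = n-k\}| = |\mathrm{SYT}(n-1,n-k)|. \]
   Context: $\S_n(321)$ is the set of $321$-avoiding permutations in $\S_n$. The block number is $\mathrm{bl}(\pi)=|\{i : \pi(j)\le i \text{ for all } j\le i\}|$ (the maximal number of summands in a direct sum decomposition of $\pi$). $\mathrm{ldes}(\pi)$ is the largest $i$ with $\pi(i)>\pi(i+1)$, or $0$ if there is none. $\mathrm{SYT}(\lambda)$ denotes the set of standard Young tableaux of shape $\lambda$. -}

module Defs where

open import Data.Nat using (ℕ; zero; suc; _+_; _∸_; _≤_; _<_; _>_; _⊔_; _≤?_; _<?_)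
open import Data.List using (List; []; _∷_; length; map; filter; upTo; take; concat; foldr)
open import Data.Nat.ListAction using (sum)
open import Data.List.Relation.Unary.All using (All; all?)
open import Data.List.Relation.Unary.Unique.Propositional using (Unique)
open import Data.List.Membership.Propositional using (_∈_)
open import Data.List.Relation.Binary.Permutation.Propositional using (_↭_)
open import Data.Product using (Σ; _×_; ∃; ∃-syntax)
open import Data.Bool using (Bool; true; false; if_then_else_)
open import Relation.Nullary using (¬_; does)
open import Relation.Binary.PropositionalEquality using (_≡_)
open import Function.Bundles using (_⇔_)

HasCard : {A : Set} → (A → Set) → ℕ → Set
HasCard {A} P m = Σ (List A) λ xs → Unique xs × ((x : A) → P x ⇔ (x ∈ xs)) × length xs ≡ m

-- Permutations in one-line notation: π = [π(1), …, π(n)] as a list of ℕ.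

range : ℕ → List ℕ
range n = map suc (upTo n)

IsPerm : ℕ → List ℕ → Set
IsPerm n π = π ↭ range n

-- 1-based entry π(i) (0 if i is out of range)
val : List ℕ → ℕ → ℕ
val []       _             = 0
val (x ∷ xs) zero          = 0
val (x ∷ xs) (suc zero)    = x
val (x ∷ xs) (suc (suc i)) = val xs (suc i)

Avoids321 : List ℕ → Set
Avoids321 π = ¬ (∃[ i ] ∃[ j ] ∃[ l ]
  (1 ≤ i × i < j × j < l × l ≤ length π × val π i > val π j × val π j > val π l))

bl : List ℕ → ℕ
bl π = length (filter (λ i → all? (λ v → v ≤? i) (take i π)) (range (length π)))

-- ldes(π) = largest i with π(i) > π(i+1), or 0 if there is none
ldes : List ℕ → ℕ
ldes π = foldr _⊔_ 0
  (filter (λ i → val π (suc i) <? val π i) (range (length π ∸ 1)))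

-- 1-based position of the first occurrence of v in π (0 if absent)
pos : ℕ → List ℕ → ℕ
pos v [] = 0
pos v (x ∷ xs) with does (Data.Nat._≟_ v x)
... | true  = 1
... | false with pos v xs
...   | zero  = 0
...   | suc p = suc (suc p)

inv : List ℕ → List ℕ
inv π = map (λ v → pos v π) (range (length π))

-- Standard Young tableaux of shape λ (λ given as a list of row lengths).

data RowsIncr : List ℕ → Set where
  []  : RowsIncr []
  [-] : ∀ {x} → RowsIncr (x ∷ [])
  _∷_ : ∀ {x y ys} → x < y → RowsIncr (y ∷ ys) → RowsIncr (x ∷ y ∷ ys)

data ColsIncr : List (List ℕ) → Set where
  []  : ColsIncr []
  [-] : ∀ {r} → ColsIncr (r ∷ [])
  _∷_ : ∀ {r s rs} →
        ((j : ℕ) → 1 ≤ j → j ≤ length s → val r j < val s j) →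
        ColsIncr (s ∷ rs) → ColsIncr (r ∷ s ∷ rs)

data HasShape : List (List ℕ) → List ℕ → Set where
  []  : HasShape [] []
  _∷_ : ∀ {r rs l ls} → length r ≡ l → HasShape rs ls → HasShape (r ∷ rs) (l ∷ ls)

IsSYT : List ℕ → List (List ℕ) → Set
IsSYT λ′ T = HasShape T λ′ × All RowsIncr T × ColsIncr T × concat T ↭ range (sum λ′)

-- Three families obey the ballot recurrence of two-row tableaux and are hence
-- equinumerous: standard Young tableaux of shape (a, c), Catalan sequences
-- (d₁ = 0, dᵢ₊₁ ≤ dᵢ + 1) of length a + 1 with a + 1 − c zeros, and reversed
-- Catalan sequences of length a + 1 with first entry a − c.
--
-- The maximum n can be inserted into a 321-avoiding permutation of [n − 1]
-- exactly at the slots at or after its last descent, and the slot chosen becomes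
-- the new last descent unless it is the final one. Recording n − 1 − ldes at each
-- step is therefore a bijection onto reversed Catalan sequences, and π ↦ π⁻¹
-- preserves 321-avoidance, which counts ldes(π⁻¹) = n − k.
--
-- A 321-avoider is uniquely an indecomposable one ⊕ another 321-avoider, and a
-- Catalan sequence splits uniquely before its second zero into a piece with one
-- zero and another Catalan sequence. Both statistics bl and zeros therefore
-- satisfy the same convolution, and since the totals agree, strong induction on
-- n shows that bl and the number of zeros are equidistributed.

module Submission where

open import Defs
open import Data.Bool using (true; false; T)
open import Data.Empty using (⊥; ⊥-elim)
open import Data.List using (List; []; _∷_; _++_; length; map; filter; upTo; applyUpTo; take; drop; foldr; concat; cartesianProduct; [_])
open import Data.List.Membership.Propositional using (_∈_; _∉_)
open import Data.List.Relation.Binary.Subset.Propositional using (_⊆_)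
open import Data.List.Membership.Propositional.Properties
open import Data.List.Properties using (length-map; length-++; length-++-sucʳ; length-upTo; map-++; upTo-∷ʳ; ++-assoc; ++-identityʳ; take++drop≡id; map-cong-local; map-∘; map-id-local; length-take; take-map; take-take; take-all; drop-all; length-drop; filter-++)
open import Data.List.Relation.Binary.Permutation.Propositional using (_↭_; ↭-refl; ↭-sym; ↭-trans; ↭-reflexive; prep; ↭⇒↭ₛ)
open import Data.List.Relation.Binary.Permutation.Propositional.Properties using (shift; ∈-resp-↭; ↭-length; drop-mid; ++-comm) renaming (++⁺ to ↭-++⁺; ++⁺ʳ to ↭-++⁺ʳ; map⁺ to ↭-map⁺)
open import Data.List.Relation.Binary.Permutation.Setoid.Properties using (Unique-resp-↭)
open import Data.List.Relation.Unary.All as All using (All; []; _∷_; all?)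
open import Data.List.Relation.Unary.All.Properties as AllP using ()
open import Data.List.Relation.Unary.AllPairs using ([]; _∷_)
open import Data.List.Relation.Unary.Any using (here; there)
open import Data.List.Relation.Unary.Unique.Propositional using (Unique)
open import Data.List.Relation.Unary.Unique.Propositional.Properties as UP using ()
open import Data.Nat using (ℕ; zero; suc; pred; _+_; _*_; _∸_; _≤_; _<_; z≤n; s≤s; _⊔_; _≟_; _<?_; _≤?_; _≡ᵇ_; s<s⁻¹; s≤s⁻¹)
open import Data.Nat.Properties
open import Data.Nat.Induction using (<-rec)
open import Data.Nat.ListAction using (sum)
open import Data.Nat.ListAction.Properties using (sum-++)
open import Data.Product using (Σ; _×_; _,_; proj₁; proj₂; ∃; ∃-syntax; assocʳ′; assocˡ′)
open import Data.Sum using (_⊎_; inj₁; inj₂; [_,_]′)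
open import Data.Unit using (⊤; tt)
open import Function.Base using (_∘_)
open import Function.Bundles using (_⇔_; mk⇔; Equivalence)
open Equivalence using (to; from)
open import Relation.Binary.Definitions using (tri<; tri≈; tri>)
open import Relation.Binary.PropositionalEquality hiding ([_])
open import Relation.Nullary using (¬_; Dec; yes; no)
open import Relation.Unary using (Decidable)

private variable A B : Set

-- Finite cardinalities

⊆-deleteFound : ∀ {x : A} {xs} ys₁ {ys₂} → All (x ≢_) xs → x ∷ xs ⊆ ys₁ ++ x ∷ ys₂ → xs ⊆ ys₁ ++ ys₂
⊆-deleteFound {x = x} ys₁ x∉xs sub {z} z∈xs = go ys₁ (sub (there z∈xs))
  where
  z≢x : z ≢ x
  z≢x z≡x = All.lookup x∉xs z∈xs (sym z≡x)
  go : ∀ ys₁ {ys₂} → z ∈ ys₁ ++ x ∷ ys₂ → z ∈ ys₁ ++ ys₂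
  go []        (here z≡x) = ⊥-elim (z≢x z≡x)
  go []        (there p)  = p
  go (y ∷ ys₁) (here z≡y) = here z≡y
  go (y ∷ ys₁) (there p)  = there (go ys₁ p)

Unique-⊆⇒length≤ : {xs ys : List A} → Unique xs → xs ⊆ ys → length xs ≤ length ys
Unique-⊆⇒length≤ {xs = []}     _             _   = z≤n
Unique-⊆⇒length≤ {xs = x ∷ xs} (x∉xs ∷ uxs) sub with ∈-∃++ (sub (here refl))
... | ys₁ , ys₂ , refl = begin
  suc (length xs)          ≤⟨ s≤s (Unique-⊆⇒length≤ uxs (⊆-deleteFound ys₁ x∉xs sub)) ⟩
  suc (length (ys₁ ++ ys₂)) ≡⟨ length-++-sucʳ ys₁ x ys₂ ⟨
  length (ys₁ ++ x ∷ ys₂)   ∎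
  where open ≤-Reasoning

Unique-⊆-length⇒↭ : {xs ys : List A} → Unique xs → xs ⊆ ys → length ys ≤ length xs → xs ↭ ys
Unique-⊆-length⇒↭ {xs = []}     {ys = []}    _ _ _  = ↭-refl
Unique-⊆-length⇒↭ {xs = x ∷ xs} (x∉xs ∷ uxs) sub len with ∈-∃++ (sub (here refl))
... | ys₁ , ys₂ , refl =
  ↭-trans (prep x (Unique-⊆-length⇒↭ uxs (⊆-deleteFound ys₁ x∉xs sub) len′)) (↭-sym (shift x ys₁ ys₂))
  where
  len′ : length (ys₁ ++ ys₂) ≤ length xs
  len′ = s≤s⁻¹ (≤-trans (≤-reflexive (sym (length-++-sucʳ ys₁ x ys₂))) len)

Unique-map-injectiveOn : ∀ (f : A → B) {xs} → (∀ {x y} → x ∈ xs → y ∈ xs → f x ≡ f y → x ≡ y) →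
                         Unique xs → Unique (map f xs)
Unique-map-injectiveOn f {[]}     _   []          = []
Unique-map-injectiveOn f {x ∷ xs} inj (x∉xs ∷ u) =
  AllP.map⁺ (All.tabulate (λ {y} y∈xs fx≡fy → All.lookup x∉xs y∈xs (inj (here refl) (there y∈xs) fx≡fy))) ∷
  Unique-map-injectiveOn f (λ p q → inj (there p) (there q)) u

HasCard-unique : {P : A → Set} {a b : ℕ} → HasCard P a → HasCard P b → a ≡ b
HasCard-unique (xs , uxs , exs , refl) (ys , uys , eys , refl) =
  ≤-antisym (Unique-⊆⇒length≤ uxs (λ p → to (eys _) (from (exs _) p)))
            (Unique-⊆⇒length≤ uys (λ p → to (exs _) (from (eys _) p)))

HasCard-resp-⇔ : {P Q : A → Set} {m : ℕ} → (∀ x → P x ⇔ Q x) → HasCard P m → HasCard Q m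
HasCard-resp-⇔ P⇔Q (xs , u , P⇔∈ , l) =
  xs , u , (λ x → mk⇔ (to (P⇔∈ x) ∘ from (P⇔Q x)) (to (P⇔Q x) ∘ from (P⇔∈ x))) , l

record Bijection {A B : Set} (P : A → Set) (Q : B → Set) : Set where
  field
    f      : A → B
    g      : B → A
    f-resp : ∀ {x} → P x → Q (f x)
    g-resp : ∀ {y} → Q y → P (g y)
    g∘f    : ∀ {x} → P x → g (f x) ≡ x
    f∘g    : ∀ {y} → Q y → f (g y) ≡ y

HasCard-resp-Bijection : {P : A → Set} {Q : B → Set} {m : ℕ} → Bijection P Q → HasCard P m → HasCard Q m
HasCard-resp-Bijection {P = P} {Q} b (xs , u , P⇔∈ , l) =
  map f xs , Unique-map-injectiveOn f f-injective u ,
  (λ y → mk⇔ (λ qy → subst (_∈ map f xs) (f∘g qy) (∈-map⁺ f (to (P⇔∈ (g y)) (g-resp qy)))) Q-∈map) ,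
  trans (length-map f xs) l
  where
  open Bijection b
  f-injective : ∀ {x y} → x ∈ xs → y ∈ xs → f x ≡ f y → x ≡ y
  f-injective {x} {y} x∈ y∈ fx≡fy = begin
    x         ≡⟨ g∘f (from (P⇔∈ x) x∈) ⟨
    g (f x)   ≡⟨ cong g fx≡fy ⟩
    g (f y)   ≡⟨ g∘f (from (P⇔∈ y) y∈) ⟩
    y         ∎
    where open ≡-Reasoning
  Q-∈map : ∀ {y} → y ∈ map f xs → Q y
  Q-∈map y∈ with ∈-map⁻ f y∈
  ... | x , x∈ , refl = f-resp (from (P⇔∈ x) x∈)

Bijection-sym : {P : A → Set} {Q : B → Set} → Bijection P Q → Bijection Q P
Bijection-sym b = record { f = g ; g = f ; f-resp = g-resp ; g-resp = f-resp ; g∘f = f∘g ; f∘g = g∘f }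
  where open Bijection b

Bijection-restrict : ∀ {P : A → Set} {Q : B → Set} (b : Bijection P Q) (s : A → ℕ) (t : B → ℕ) →
                     (∀ {x} → P x → s x ≡ suc (t (Bijection.f b x))) → ∀ k →
                     Bijection (λ x → P x × s x ≡ suc k) (λ y → Q y × t y ≡ k)
Bijection-restrict b s t st k = record
  { f = f ; g = g
  ; f-resp = λ { (p , e) → f-resp p , suc-injective (trans (sym (st p)) e) }
  ; g-resp = λ { (q , e) → g-resp q , trans (st (g-resp q)) (cong suc (trans (cong t (f∘g q)) e)) }
  ; g∘f = λ { (p , _) → g∘f p } ; f∘g = λ { (q , _) → f∘g q } }
  where open Bijection b

HasCard-empty : {P : A → Set} → (∀ x → ¬ P x) → HasCard P 0
HasCard-empty n = [] , [] , (λ x → mk⇔ (λ p → ⊥-elim (n x p)) (λ ())) , refl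

HasCard-singleton : {P : A → Set} (a : A) → (∀ x → P x ⇔ (x ≡ a)) → HasCard P 1
HasCard-singleton a e = a ∷ [] , [] ∷ [] ,
  (λ x → mk⇔ (λ p → here (to (e x) p)) (λ { (here q) → from (e x) q ; (there ()) })) , refl

HasCard-⊎ : {P Q : A → Set} {a b : ℕ} → HasCard P a → HasCard Q b → (∀ x → P x → Q x → ⊥) →
       HasCard (λ x → P x ⊎ Q x) (a + b)
HasCard-⊎ {P = P} {Q} (xs , ux , ex , refl) (ys , uy , ey , refl) dis =
  xs ++ ys , UP.++⁺ ux uy (λ { (p , q) → dis _ (from (ex _) p) (from (ey _) q) }) ,
  (λ x → mk⇔ (λ { (inj₁ p) → ∈-++⁺ˡ (to (ex x) p) ; (inj₂ q) → ∈-++⁺ʳ xs (to (ey x) q) })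
             (λ p → h p)) ,
  length-++ xs
  where
  h : ∀ {x} → x ∈ xs ++ ys → P x ⊎ Q x
  h {x} p with ∈-++⁻ xs p
  ... | inj₁ q = inj₁ (from (ex x) q)
  ... | inj₂ q = inj₂ (from (ey x) q)

HasCard-split : {F R₁ R₂ : A → Set} {m₁ m₂ : ℕ} →
                HasCard (λ x → F x × R₁ x) m₁ → HasCard (λ x → F x × R₂ x) m₂ →
                (∀ x → F x → R₁ x ⊎ R₂ x) → (∀ x → F x → R₁ x → R₂ x → ⊥) → HasCard F (m₁ + m₂)
HasCard-split {F = F} {R₁} {R₂} h₁ h₂ cases disjoint =
  HasCard-resp-⇔ split (HasCard-⊎ h₁ h₂ (λ x p q → disjoint x (proj₁ p) (proj₂ p) (proj₂ q)))
  where
  split : ∀ x → ((F x × R₁ x) ⊎ (F x × R₂ x)) ⇔ F x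
  split x = mk⇔ [ proj₁ , proj₁ ]′ (λ fx → Data.Sum.map (fx ,_) (fx ,_) (cases x fx))

length-cartesianProduct : (xs : List A) (ys : List B) → length (cartesianProduct xs ys) ≡ length xs * length ys
length-cartesianProduct [] ys = refl
length-cartesianProduct (x ∷ xs) ys = trans (length-++ (map (x ,_) ys))
  (cong₂ _+_ (length-map (x ,_) ys) (length-cartesianProduct xs ys))

HasCard-× : {P : A → Set} {Q : B → Set} {a b : ℕ} → HasCard P a → HasCard Q b →
       HasCard (λ (z : A × B) → P (proj₁ z) × Q (proj₂ z)) (a * b)
HasCard-× (xs , ux , ex , refl) (ys , uy , ey , refl) =
  cartesianProduct xs ys , UP.cartesianProduct⁺ ux uy ,
  (λ { (x , y) → mk⇔ (λ { (p , q) → ∈-cartesianProduct⁺ (to (ex x) p) (to (ey y) q) })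
                     (λ r → let (p , q) = ∈-cartesianProduct⁻ xs ys r in from (ex x) p , from (ey y) q) }) ,
  length-cartesianProduct xs ys

HasCard-⋃ : (is : List ℕ) → Unique is → (P : ℕ → A → Set) → (cards : ℕ → ℕ) →
       (∀ i → HasCard (P i) (cards i)) → (∀ i j x → P i x → P j x → i ≡ j) →
       HasCard (λ x → ∃ λ i → i ∈ is × P i x) (sum (map cards is))
HasCard-⋃ [] u P cards hs dis = HasCard-empty (λ { x (i , () , _) })
HasCard-⋃ (i ∷ is) (ni ∷ u) P cards hs dis =
  HasCard-resp-⇔ e (HasCard-⊎ (hs i) (HasCard-⋃ is u P cards hs dis)
    (λ { x p (j , j∈ , q) → All.lookup ni j∈ (dis i j x p q) }))
  where
  e : ∀ x → (P i x ⊎ ∃ λ j → j ∈ is × P j x) ⇔ (∃ λ j → j ∈ i ∷ is × P j x)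
  e x = mk⇔ (λ { (inj₁ p) → i , here refl , p ; (inj₂ (j , j∈ , q)) → j , there j∈ , q })
            (λ { (j , here refl , p) → inj₁ p ; (j , there j∈ , q) → inj₂ (j , j∈ , q) })

HasCard-filter : {P : A → Set} {m : ℕ} → HasCard P m → (Q : A → Set) → (∀ x → Dec (Q x)) →
                 ∃ λ m′ → HasCard (λ x → P x × Q x) m′
HasCard-filter (xs , u , e , refl) Q Q? =
  _ , filter Q? xs , UP.filter⁺ Q? u ,
  (λ x → mk⇔ (λ { (p , q) → ∈-filter⁺ Q? (to (e x) p) q })
             (λ r → let (p , q) = ∈-filter⁻ Q? r in from (e x) p , q)) , refl

-- Ranges and permutations

range-suc : ∀ m → range (suc m) ≡ range m ++ [ suc m ]
range-suc m = trans (cong (map suc) (sym (upTo-∷ʳ m))) (map-++ suc (upTo m) [ m ])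

∈-range⁻ : ∀ {m x} → x ∈ range m → 1 ≤ x × x ≤ m
∈-range⁻ {m} p with ∈-map⁻ suc p
... | i , q , refl = s≤s z≤n , ∈-upTo⁻ q

∈-range⁺ : ∀ {m x} → 1 ≤ x → x ≤ m → x ∈ range m
∈-range⁺ {m} {suc x} (s≤s _) le = ∈-map⁺ suc (∈-upTo⁺ le)

Unique-range : ∀ m → Unique (range m)
Unique-range m = UP.map⁺ suc-injective (UP.upTo⁺ m)

length-range : ∀ m → length (range m) ≡ m
length-range m = trans (length-map suc (upTo m)) (length-upTo m)

Convolution : {B C : Set} → ℕ → (ℕ → B → Set) → (ℕ → C → Set) → B × C → Set
Convolution n Q R z = ∃ λ c → c ∈ range n × (Q c (proj₁ z) × R c (proj₂ z))

HasCard-Convolution : ∀ {B C : Set} n {Q : ℕ → B → Set} {R : ℕ → C → Set} {f g : ℕ → ℕ} →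
                      (∀ c → HasCard (Q c) (f c)) → (∀ c → HasCard (R c) (g c)) →
                      (∀ {c c′ x} → Q c x → Q c′ x → c ≡ c′) →
                      HasCard (Convolution n Q R) (sum (map (λ c → f c * g c) (range n)))
HasCard-Convolution n {Q} {R} {f} {g} hQ hR Q-determines =
  HasCard-⋃ (range n) (Unique-range n) (λ c z → Q c (proj₁ z) × R c (proj₂ z)) (λ c → f c * g c)
    (λ c → HasCard-× (hQ c) (hR c)) (λ _ _ _ p q → Q-determines (proj₁ p) (proj₁ q))

Convolution-× : ∀ {B C : Set} {n} {Q : ℕ → B → Set} {R : ℕ → C → Set} {T : C → Set} z →
                Convolution n Q (λ c y → R c y × T y) z ⇔ (Convolution n Q R z × T (proj₂ z))
Convolution-× z = mk⇔ (λ { (c , c∈ , q , r , t) → (c , c∈ , q , r) , t })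
                      (λ { ((c , c∈ , q , r) , t) → c , c∈ , q , r , t })

IsPerm⇒Unique : ∀ {n π} → IsPerm n π → Unique π
IsPerm⇒Unique {n} p = Unique-resp-↭ (setoid ℕ) (↭⇒↭ₛ (↭-sym p)) (Unique-range n)

IsPerm⇒length : ∀ {n π} → IsPerm n π → length π ≡ n
IsPerm⇒length {n} p = trans (↭-length p) (length-range n)

∈-IsPerm⁻ : ∀ {n π x} → IsPerm n π → x ∈ π → 1 ≤ x × x ≤ n
∈-IsPerm⁻ p q = ∈-range⁻ (∈-resp-↭ p q)

∈-IsPerm⁺ : ∀ {n π x} → IsPerm n π → 1 ≤ x → x ≤ n → x ∈ π
∈-IsPerm⁺ p a b = ∈-resp-↭ (↭-sym p) (∈-range⁺ a b)

Unique⇒IsPerm : ∀ {n π} → Unique π → (∀ {x} → x ∈ π → 1 ≤ x × x ≤ n) → length π ≡ n → IsPerm n π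
Unique⇒IsPerm {n} {π} u mem l =
  Unique-⊆-length⇒↭ u (λ q → let (a , b) = mem q in ∈-range⁺ a b) (≤-reflexive (trans (length-range n) (sym l)))

-- Catalan sequences and two-row tableaux

val-++ˡ : ∀ (xs ys : List ℕ) j → j ≤ length xs → val (xs ++ ys) j ≡ val xs j
val-++ˡ [] ys zero le = val0 ys
  where val0 : ∀ zs → val zs 0 ≡ 0
        val0 [] = refl
        val0 (_ ∷ _) = refl
val-++ˡ (x ∷ xs) ys zero le = refl
val-++ˡ (x ∷ xs) ys (suc zero) le = refl
val-++ˡ (x ∷ xs) ys (suc (suc j)) (s≤s le) = val-++ˡ xs ys (suc j) le

val-++ʳ : ∀ (xs ys : List ℕ) j → val (xs ++ ys) (length xs + suc j) ≡ val ys (suc j)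
val-++ʳ [] ys j = refl
val-++ʳ (x ∷ []) ys j = refl
val-++ʳ (x ∷ y ∷ xs) ys j = val-++ʳ (y ∷ xs) ys j

val∈ : ∀ (xs : List ℕ) j → 1 ≤ j → j ≤ length xs → val xs j ∈ xs
val∈ (x ∷ xs) (suc zero) _ _ = here refl
val∈ (x ∷ xs) (suc (suc j)) _ (s≤s le) = there (val∈ xs (suc j) (s≤s z≤n) le)

val-last : ∀ (xs : List ℕ) y → val (xs ++ [ y ]) (suc (length xs)) ≡ y
val-last xs y = trans (cong (val (xs ++ [ y ])) (+-comm 1 (length xs))) (val-++ʳ xs [ y ] 0)

dropLast : List ℕ → List ℕ
dropLast [] = []
dropLast (x ∷ []) = []
dropLast (x ∷ y ∷ r) = x ∷ dropLast (y ∷ r)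

dropLast-∷ʳ : ∀ xs y → dropLast (xs ++ [ y ]) ≡ xs
dropLast-∷ʳ [] y = refl
dropLast-∷ʳ (x ∷ []) y = refl
dropLast-∷ʳ (x ∷ z ∷ xs) y = cong (x ∷_) (dropLast-∷ʳ (z ∷ xs) y)

suc-∸ : ∀ {a c} → c ≤ a → suc a ∸ c ≡ suc (a ∸ c)
suc-∸ le = +-∸-assoc 1 le

head₀ : List ℕ → ℕ
head₀ [] = 0
head₀ (x ∷ _) = x
tail₀ : List ℕ → List ℕ
tail₀ [] = []
tail₀ (_ ∷ r) = r

RevCatalan : List ℕ → Set
RevCatalan [] = ⊤
RevCatalan (x ∷ []) = x ≡ 0
RevCatalan (x ∷ y ∷ r) = x ≤ suc y × RevCatalan (y ∷ r)

RevCatalanOfLength : ℕ → List ℕ → Set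
RevCatalanOfLength n r = length r ≡ n × RevCatalan r

RevCatalanHead : ℕ → ℕ → List ℕ → Set
RevCatalanHead a c r = length r ≡ suc a × RevCatalan r × head₀ r ≡ a ∸ c

RevCatalan-head≤length : ∀ x r → RevCatalan (x ∷ r) → x ≤ length r
RevCatalan-head≤length x [] refl = z≤n
RevCatalan-head≤length x (y ∷ r) (le , v) = ≤-trans le (s≤s (RevCatalan-head≤length y r v))

HeadRises HeadNotRising : List ℕ → Set
HeadRises r = head₀ r ≡ suc (head₀ (tail₀ r))
HeadNotRising r = head₀ r ≤ head₀ (tail₀ r)

revCatalan-cases : ∀ a c r → RevCatalanHead (suc a) c r → HeadRises r ⊎ HeadNotRising r
revCatalan-cases a c (x ∷ y ∷ r) (l , (le , v) , h) with m≤n⇒m<n∨m≡n le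
... | inj₁ lt = inj₂ (≤-pred lt)
... | inj₂ eq = inj₁ eq

revCatalan-disjoint : ∀ r → HeadRises r → HeadNotRising r → ⊥
revCatalan-disjoint (x ∷ r) refl le = 1+n≰n le

revCatalan-grow₁ : ∀ {a c} → c ≤ a → Bijection (RevCatalanHead a c) (λ r → RevCatalanHead (suc a) c r × HeadRises r)
revCatalan-grow₁ {a} {c} c≤a = record { f = λ r → suc (head₀ r) ∷ r ; g = tail₀ ; f-resp = f-resp ; g-resp = g-resp ; g∘f = λ _ → refl ; f∘g = f∘g }
  where
  f-resp : ∀ {r} → RevCatalanHead a c r → RevCatalanHead (suc a) c (suc (head₀ r) ∷ r) × HeadRises (suc (head₀ r) ∷ r)
  f-resp {x ∷ r} (l , v , h) = (cong suc l , (≤-refl , v) , trans (cong suc h) (sym (suc-∸ c≤a))) , refl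
  g-resp : ∀ {r} → RevCatalanHead (suc a) c r × HeadRises r → RevCatalanHead a c (tail₀ r)
  g-resp {x ∷ y ∷ r} ((l , (le , v) , h) , e) = suc-injective l , v ,
    suc-injective (trans (sym e) (trans h (suc-∸ c≤a)))
  f∘g : ∀ {r} → RevCatalanHead (suc a) c r × HeadRises r → suc (head₀ (tail₀ r)) ∷ tail₀ r ≡ r
  f∘g {x ∷ y ∷ r} (_ , e) = cong (_∷ y ∷ r) (sym e)

revCatalan-square₁ : ∀ a r → RevCatalanHead (suc a) (suc a) r → HeadRises r → ⊥
revCatalan-square₁ a (x ∷ r) (l , v , h) e = 0≢1+n (trans (sym (trans h (n∸n≡0 a))) e)

revCatalan-grow₂ : ∀ {a c} → c ≤ a → Bijection (RevCatalanHead (suc a) c) (λ r → RevCatalanHead (suc a) (suc c) r × HeadNotRising r)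
revCatalan-grow₂ {a} {c} c≤a = record
  { f = λ r → pred (head₀ r) ∷ tail₀ r ; g = λ r → suc (head₀ r) ∷ tail₀ r ; f-resp = f-resp ; g-resp = g-resp ; g∘f = g∘f ; f∘g = f∘g }
  where
  f∘g : ∀ {r} → RevCatalanHead (suc a) (suc c) r × HeadNotRising r → pred (head₀ (suc (head₀ r) ∷ tail₀ r)) ∷ tail₀ (suc (head₀ r) ∷ tail₀ r) ≡ r
  f∘g {x ∷ r} _ = refl
  f-resp : ∀ {r} → RevCatalanHead (suc a) c r →
           RevCatalanHead (suc a) (suc c) (pred (head₀ r) ∷ tail₀ r) × HeadNotRising (pred (head₀ r) ∷ tail₀ r)
  f-resp {x ∷ y ∷ r} (l , (le , v) , h) = (l , (≤-trans (pred-mono-≤ le) (n≤1+n y) , v) , cong pred (trans h (suc-∸ c≤a))) , pred-mono-≤ le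
  g-resp : ∀ {r} → RevCatalanHead (suc a) (suc c) r × HeadNotRising r → RevCatalanHead (suc a) c (suc (head₀ r) ∷ tail₀ r)
  g-resp {x ∷ y ∷ r} ((l , (_ , v) , h) , le) = l , (s≤s le , v) , trans (cong suc h) (sym (suc-∸ c≤a))
  g∘f : ∀ {r} → RevCatalanHead (suc a) c r → suc (pred (head₀ r)) ∷ tail₀ r ≡ r
  g∘f {x ∷ y ∷ r} (l , v , h) rewrite trans h (suc-∸ c≤a) = refl

revCatalan-flat₂ : ∀ a r → RevCatalanHead (suc a) 0 r → HeadNotRising r → ⊥
revCatalan-flat₂ a (x ∷ y ∷ r) (l , (_ , v) , refl) le =
  1+n≰n (≤-trans le (≤-trans (RevCatalan-head≤length y r v) (≤-reflexive (suc-injective (suc-injective l)))))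

revCatalan-base : HasCard (RevCatalanHead 0 0) 1
revCatalan-base = HasCard-singleton (0 ∷ []) e
  where
  t1 : ∀ r → RevCatalanHead 0 0 r → r ≡ 0 ∷ []
  t1 (x ∷ []) (refl , refl , _) = refl
  e : ∀ r → RevCatalanHead 0 0 r ⇔ (r ≡ 0 ∷ [])
  e r = mk⇔ (t1 r) (λ { refl → refl , refl , refl })

CatalanAfter : ℕ → List ℕ → Set
CatalanAfter p [] = ⊤
CatalanAfter p (x ∷ xs) = x ≤ suc p × CatalanAfter x xs

Catalan : List ℕ → Set
Catalan [] = ⊤
Catalan (x ∷ xs) = x ≡ 0 × CatalanAfter 0 xs

zeros : List ℕ → ℕ
zeros [] = 0
zeros (zero ∷ xs) = suc (zeros xs)
zeros (suc _ ∷ xs) = zeros xs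

CatalanZeros : ℕ → ℕ → List ℕ → Set
CatalanZeros a c d = length d ≡ suc a × Catalan d × zeros d ≡ suc a ∸ c

zeros≤length : ∀ xs → zeros xs ≤ length xs
zeros≤length [] = z≤n
zeros≤length (zero ∷ xs) = s≤s (zeros≤length xs)
zeros≤length (suc x ∷ xs) = m≤n⇒m≤1+n (zeros≤length xs)

CatalanAfter-mono : ∀ {p q} xs → p ≤ q → CatalanAfter p xs → CatalanAfter q xs
CatalanAfter-mono [] le v = tt
CatalanAfter-mono (x ∷ xs) le (a , v) = ≤-trans a (s≤s le) , v

lift : List ℕ → List ℕ
lift [] = []
lift (zero ∷ xs) = xs
lift (suc x ∷ xs) = suc (suc x) ∷ lift xs

low : List ℕ → List ℕ
low (suc (suc x) ∷ xs) = suc x ∷ low xs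
low [] = 0 ∷ []
low (zero ∷ xs) = 0 ∷ zero ∷ xs
low (suc zero ∷ xs) = 0 ∷ suc zero ∷ xs

lift-Catalan : ∀ {p} xs → CatalanAfter p xs → CatalanAfter (suc p) (lift xs)
lift-Catalan [] v = tt
lift-Catalan (zero ∷ xs) (_ , v) = CatalanAfter-mono xs z≤n v
lift-Catalan (suc x ∷ xs) (le , v) = s≤s le , lift-Catalan xs v

zeros-lift : ∀ xs {k} → zeros xs ≡ suc k → zeros (lift xs) ≡ k
zeros-lift (zero ∷ xs) e = suc-injective e
zeros-lift (suc x ∷ xs) e = zeros-lift xs e

length-lift : ∀ xs {k} → zeros xs ≡ suc k → suc (length (lift xs)) ≡ length xs
length-lift (zero ∷ xs) e = refl
length-lift (suc x ∷ xs) e = cong suc (length-lift xs e)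

low-Catalan : ∀ {p} t → CatalanAfter (suc p) t → CatalanAfter p (low t)
low-Catalan [] v = z≤n , tt
low-Catalan (zero ∷ xs) v = z≤n , (z≤n , proj₂ v)
low-Catalan (suc zero ∷ xs) v = z≤n , (s≤s z≤n , proj₂ v)
low-Catalan (suc (suc x) ∷ xs) (s≤s le , v) = le , low-Catalan xs v

zeros-low : ∀ t → zeros (low t) ≡ suc (zeros t)
zeros-low [] = refl
zeros-low (zero ∷ xs) = refl
zeros-low (suc zero ∷ xs) = refl
zeros-low (suc (suc x) ∷ xs) = zeros-low xs

length-low : ∀ t → length (low t) ≡ suc (length t)
length-low [] = refl
length-low (zero ∷ xs) = refl
length-low (suc zero ∷ xs) = refl
length-low (suc (suc x) ∷ xs) = cong suc (length-low xs)

low-leadingZero : ∀ ys → CatalanAfter 0 ys → low ys ≡ 0 ∷ ys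
low-leadingZero [] v = refl
low-leadingZero (zero ∷ ys) v = refl
low-leadingZero (suc zero ∷ ys) v = refl
low-leadingZero (suc (suc x) ∷ ys) (s≤s () , v)

low-lift : ∀ {p} xs {k} → CatalanAfter p xs → zeros xs ≡ suc k → low (lift xs) ≡ xs
low-lift (zero ∷ xs) (_ , v) e = low-leadingZero xs v
low-lift (suc x ∷ xs) (_ , v) e = cong (suc x ∷_) (low-lift xs v e)

lift-low : ∀ t → lift (low t) ≡ t
lift-low [] = refl
lift-low (zero ∷ xs) = refl
lift-low (suc zero ∷ xs) = refl
lift-low (suc (suc x) ∷ xs) = cong (suc (suc x) ∷_) (lift-low xs)

SecondIsZero SecondIsOne : List ℕ → Set
SecondIsZero d = head₀ (tail₀ d) ≡ 0
SecondIsOne d = head₀ (tail₀ d) ≡ 1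

catalanZeros-cases : ∀ a c d → CatalanZeros (suc a) c d → SecondIsZero d ⊎ SecondIsOne d
catalanZeros-cases a c (.0 ∷ zero ∷ d) (l , (refl , v) , z) = inj₁ refl
catalanZeros-cases a c (.0 ∷ suc zero ∷ d) (l , (refl , v) , z) = inj₂ refl
catalanZeros-cases a c (.0 ∷ suc (suc x) ∷ d) (l , (refl , (s≤s () , _)) , z)

catalanZeros-disjoint : ∀ d → SecondIsZero d → SecondIsOne d → ⊥
catalanZeros-disjoint d e1 e2 = 0≢1+n (trans (sym e1) e2)

catalanZeros-grow₁ : ∀ {a c} → c ≤ a → Bijection (CatalanZeros a c) (λ d → CatalanZeros (suc a) c d × SecondIsZero d)
catalanZeros-grow₁ {a} {c} c≤a = record { f = 0 ∷_ ; g = tail₀ ; f-resp = f-resp ; g-resp = g-resp ; g∘f = λ _ → refl ; f∘g = f∘g }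
  where
  f-resp : ∀ {d} → CatalanZeros a c d → CatalanZeros (suc a) c (0 ∷ d) × SecondIsZero (0 ∷ d)
  f-resp {.0 ∷ d} (l , (refl , v) , z) =
    (cong suc l , (refl , (z≤n , v)) , trans (cong suc z) (sym (suc-∸ (≤-trans c≤a (n≤1+n a))))) , refl
  g-resp : ∀ {d} → CatalanZeros (suc a) c d × SecondIsZero d → CatalanZeros a c (tail₀ d)
  g-resp {.0 ∷ .0 ∷ d} ((l , (refl , (_ , v)) , z) , refl) =
    suc-injective l , (refl , v) , suc-injective (trans z (suc-∸ (≤-trans c≤a (n≤1+n a))))
  f∘g : ∀ {d} → CatalanZeros (suc a) c d × SecondIsZero d → 0 ∷ tail₀ d ≡ d
  f∘g {.0 ∷ .0 ∷ d} ((l , (refl , _) , z) , refl) = refl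

catalanZeros-square₁ : ∀ a d → CatalanZeros (suc a) (suc a) d → SecondIsZero d → ⊥
catalanZeros-square₁ a (.0 ∷ .0 ∷ d) (l , (refl , _) , z) refl = 1+n≢0 (suc-injective (trans z (m+n∸n≡m 1 a)))

catalanZeros-grow₂ : ∀ {a c} → c ≤ a → Bijection (CatalanZeros (suc a) c) (λ d → CatalanZeros (suc a) (suc c) d × SecondIsOne d)
catalanZeros-grow₂ {a} {c} c≤a = record
  { f = λ d → 0 ∷ 1 ∷ lift (tail₀ d) ; g = λ d → 0 ∷ low (tail₀ (tail₀ d)) ; f-resp = f-resp ; g-resp = g-resp ; g∘f = g∘f ; f∘g = f∘g }
  where
  c≤1a : c ≤ suc a
  c≤1a = ≤-trans c≤a (n≤1+n a)
  zr : ∀ d → zeros (0 ∷ d) ≡ suc (suc a) ∸ c → zeros d ≡ suc (a ∸ c)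
  zr d z = suc-injective (trans z (trans (suc-∸ c≤1a) (cong suc (suc-∸ c≤a))))
  f-resp : ∀ {d} → CatalanZeros (suc a) c d →
           CatalanZeros (suc a) (suc c) (0 ∷ 1 ∷ lift (tail₀ d)) × SecondIsOne (0 ∷ 1 ∷ lift (tail₀ d))
  f-resp {.0 ∷ d} (l , (refl , v) , z) =
    (cong suc (trans (length-lift d (zr d z)) (suc-injective l)) , (refl , (≤-refl , lift-Catalan d v)) ,
     trans (cong suc (zeros-lift d (zr d z))) (sym (suc-∸ c≤a))) , refl
  g-resp : ∀ {d} → CatalanZeros (suc a) (suc c) d × SecondIsOne d → CatalanZeros (suc a) c (0 ∷ low (tail₀ (tail₀ d)))
  g-resp {.0 ∷ .1 ∷ t} ((l , (refl , (_ , v)) , z) , refl) =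
    trans (cong suc (length-low t)) l , (refl , low-Catalan t v) ,
    trans (cong suc (zeros-low t)) (trans (cong suc (trans z (suc-∸ c≤a))) (sym (trans (suc-∸ c≤1a) (cong suc (suc-∸ c≤a)))))
  g∘f : ∀ {d} → CatalanZeros (suc a) c d → 0 ∷ low (lift (tail₀ d)) ≡ d
  g∘f {.0 ∷ d} (l , (refl , v) , z) = cong (0 ∷_) (low-lift d v (zr d z))
  f∘g : ∀ {d} → CatalanZeros (suc a) (suc c) d × SecondIsOne d → 0 ∷ 1 ∷ lift (low (tail₀ (tail₀ d))) ≡ d
  f∘g {.0 ∷ .1 ∷ t} ((l , (refl , _) , z) , refl) = cong (λ w → 0 ∷ 1 ∷ w) (lift-low t)

catalanZeros-flat₂ : ∀ a d → CatalanZeros (suc a) 0 d → SecondIsOne d → ⊥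
catalanZeros-flat₂ a (.0 ∷ .1 ∷ t) (l , (refl , _) , z) refl =
  1+n≰n (subst (_≤ length t) (suc-injective (trans z (sym l))) (zeros≤length t))

catalanZeros-base : HasCard (CatalanZeros 0 0) 1
catalanZeros-base = HasCard-singleton (0 ∷ []) e
  where
  t1 : ∀ r → CatalanZeros 0 0 r → r ≡ 0 ∷ []
  t1 (.0 ∷ []) (refl , (refl , _) , _) = refl
  e : ∀ r → CatalanZeros 0 0 r ⇔ (r ≡ 0 ∷ [])
  e r = mk⇔ (t1 r) (λ { refl → refl , (refl , tt) , refl })

SYT₂ : ℕ → ℕ → List (List ℕ) → Set
SYT₂ a c = IsSYT (a ∷ c ∷ [])

row1 row2 : List (List ℕ) → List ℕ
row1 (r ∷ _) = r
row1 [] = []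
row2 (_ ∷ r ∷ _) = r
row2 _ = []

RowsIncr-∷ʳ : ∀ {r y} → RowsIncr r → All (_< y) r → RowsIncr (r ++ [ y ])
RowsIncr-∷ʳ [] [] = [-]
RowsIncr-∷ʳ [-] (p ∷ []) = p ∷ [-]
RowsIncr-∷ʳ (lt ∷ ri) (p ∷ ps) = lt ∷ RowsIncr-∷ʳ ri ps

RowsIncr-dropLast : ∀ {r} → RowsIncr r → RowsIncr (dropLast r)
RowsIncr-dropLast [] = []
RowsIncr-dropLast [-] = []
RowsIncr-dropLast (lt ∷ [-]) = [-]
RowsIncr-dropLast (lt ∷ (lt' ∷ ri)) = lt ∷ RowsIncr-dropLast (lt' ∷ ri)

RowsIncr-max-last : ∀ {r N} → RowsIncr r → (∀ {x} → x ∈ r → x ≤ N) → N ∈ r → r ≡ dropLast r ++ [ N ]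
RowsIncr-max-last [-] bd (here refl) = refl
RowsIncr-max-last {x ∷ y ∷ r} (lt ∷ ri) bd (here refl) = ⊥-elim (<⇒≱ lt (bd (there (here refl))))
RowsIncr-max-last {x ∷ y ∷ r} (lt ∷ ri) bd (there p) = cong (x ∷_) (RowsIncr-max-last ri (λ q → bd (there q)) p)

Unique-++-disjoint : ∀ {xs ys : List ℕ} {x} → Unique (xs ++ ys) → x ∈ xs → x ∈ ys → ⊥
Unique-++-disjoint {x' ∷ xs} (a ∷ u) (here refl) q = All.lookup a (∈-++⁺ʳ xs q) refl
Unique-++-disjoint {x' ∷ xs} (a ∷ u) (there p) q = Unique-++-disjoint u p q

length-dropLast : ∀ r N → r ≡ dropLast r ++ [ N ] → length r ≡ suc (length (dropLast r))
length-dropLast r N e = trans (cong length e) (trans (length-++ (dropLast r)) (+-comm (length (dropLast r)) 1))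

twoRows : ∀ {T a c} → HasShape T (a ∷ c ∷ []) → Σ (List ℕ) λ r1 → Σ (List ℕ) λ r2 → T ≡ r1 ∷ r2 ∷ []
twoRows (_∷_ {r = r1} _ (_∷_ {r = r2} _ [])) = r1 , r2 , refl

addToRow₁ addToRow₂ : ℕ → List (List ℕ) → List (List ℕ)
addToRow₁ N T = (row1 T ++ [ N ]) ∷ row2 T ∷ []
addToRow₂ N T = row1 T ∷ (row2 T ++ [ N ]) ∷ []
dropFromRow₁ dropFromRow₂ : List (List ℕ) → List (List ℕ)
dropFromRow₁ T = dropLast (row1 T) ∷ row2 T ∷ []
dropFromRow₂ T = row1 T ∷ dropLast (row2 T) ∷ []

InRow₁ InRow₂ : ℕ → List (List ℕ) → Set
InRow₁ N T = N ∈ row1 T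
InRow₂ N T = N ∈ row2 T

concat-twoRows : ∀ (r1 r2 : List ℕ) → concat (r1 ∷ r2 ∷ []) ≡ r1 ++ r2
concat-twoRows r1 r2 = cong (r1 ++_) (++-identityʳ r2)

entry≤size : ∀ (r1 r2 : List ℕ) {s x} → concat (r1 ∷ r2 ∷ []) ↭ range s → x ∈ r1 ++ r2 → x ≤ s
entry≤size r1 r2 p q = proj₂ (∈-range⁻ (∈-resp-↭ p (subst (_ ∈_) (sym (concat-twoRows r1 r2)) q)))

syt-cases : ∀ a c T → SYT₂ (suc a) c T → InRow₁ (suc (a + (c + 0))) T ⊎ InRow₂ (suc (a + (c + 0))) T
syt-cases a c T (sh , _ , _ , p) with twoRows sh
... | r1 , r2 , refl = ∈-++⁻ r1 (subst (_ ∈_) (concat-twoRows r1 r2) (∈-resp-↭ (↭-sym p) (∈-range⁺ (s≤s z≤n) ≤-refl)))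

syt-disjoint : ∀ a c T → SYT₂ (suc a) c T → InRow₁ (suc (a + (c + 0))) T → InRow₂ (suc (a + (c + 0))) T → ⊥
syt-disjoint a c T (sh , _ , _ , p) q1 q2 with twoRows sh
... | r1 , r2 , refl = Unique-++-disjoint (subst Unique (concat-twoRows r1 r2) (IsPerm⇒Unique p)) q1 q2

syt-grow₁ : ∀ {a c} → c ≤ a → Bijection (SYT₂ a c) (λ T → SYT₂ (suc a) c T × InRow₁ (suc (a + (c + 0))) T)
syt-grow₁ {a} {c} c≤a = record { f = addToRow₁ N ; g = dropFromRow₁ ; f-resp = f-resp ; g-resp = g-resp ; g∘f = g∘f ; f∘g = f∘g }
  where
  s = a + (c + 0)
  N = suc s
  f-resp : ∀ {T} → SYT₂ a c T → SYT₂ (suc a) c (addToRow₁ N T) × InRow₁ N (addToRow₁ N T)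
  f-resp {T} (sh , rows , cols , p) with twoRows sh
  f-resp {T} (e1 ∷ (e2 ∷ []) , ri1 ∷ (ri2 ∷ []) , col ∷ [-] , p) | r1 , r2 , refl =
    (trans (length-++ r1) (trans (+-comm (length r1) 1) (cong suc e1)) ∷ (e2 ∷ []) ,
     RowsIncr-∷ʳ ri1 (All.tabulate (λ q → s≤s (entry≤size r1 r2 p (∈-++⁺ˡ q)))) ∷ (ri2 ∷ []) ,
     (λ j 1≤j j≤ → subst (_< val r2 j) (sym (val-++ˡ r1 [ N ] j (≤-trans j≤ (≤-trans (≤-reflexive e2) (≤-trans c≤a (≤-reflexive (sym e1)))))))
                    (col j 1≤j j≤)) ∷ [-] ,
     ↭-trans (↭-reflexive (trans (concat-twoRows (r1 ++ [ N ]) r2) (++-assoc r1 [ N ] r2)))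
       (↭-trans (shift N r1 r2) (↭-trans (++-comm [ N ] (r1 ++ r2))
         (↭-trans (↭-++⁺ʳ [ N ] (↭-trans (↭-reflexive (sym (concat-twoRows r1 r2))) p)) (↭-reflexive (sym (range-suc s))))))) ,
    ∈-++⁺ʳ r1 (here refl)
  g-resp : ∀ {T} → SYT₂ (suc a) c T × InRow₁ N T → SYT₂ a c (dropFromRow₁ T)
  g-resp {T} ((sh , rows , cols , p) , q) with twoRows sh
  g-resp {T} ((e1 ∷ (e2 ∷ []) , ri1 ∷ (ri2 ∷ []) , col ∷ [-] , p) , q) | r1 , r2 , refl =
    suc-injective (trans (sym (length-dropLast r1 N ed)) e1) ∷ (e2 ∷ []) , RowsIncr-dropLast ri1 ∷ (ri2 ∷ []) ,
    (λ j 1≤j j≤ → subst (_< val r2 j)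
        (trans (cong (λ w → val w j) ed) (val-++ˡ (dropLast r1) [ N ] j (≤-trans j≤ (≤-trans (≤-reflexive e2) (≤-trans c≤a (≤-reflexive (sym (suc-injective (trans (sym (length-dropLast r1 N ed)) e1)))))))))
        (col j 1≤j j≤)) ∷ [-] ,
    ↭-trans (↭-reflexive (concat-twoRows (dropLast r1) r2))
      (subst (λ w → dropLast r1 ++ r2 ↭ w) (++-identityʳ (range s))
        (drop-mid (dropLast r1) (range s)
          (↭-trans (↭-reflexive (trans (sym (++-assoc (dropLast r1) [ N ] r2)) (trans (cong (_++ r2) (sym ed)) (sym (concat-twoRows r1 r2)))))
            (↭-trans p (↭-reflexive (range-suc s))))))
    where
    ed : r1 ≡ dropLast r1 ++ [ N ]
    ed = RowsIncr-max-last ri1 (λ x → entry≤size r1 r2 p (∈-++⁺ˡ x)) q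
  g∘f : ∀ {T} → SYT₂ a c T → dropFromRow₁ (addToRow₁ N T) ≡ T
  g∘f {T} (sh , _) with twoRows sh
  ... | r1 , r2 , refl = cong (_∷ r2 ∷ []) (dropLast-∷ʳ r1 N)
  f∘g : ∀ {T} → SYT₂ (suc a) c T × InRow₁ N T → addToRow₁ N (dropFromRow₁ T) ≡ T
  f∘g {T} ((sh , rows , cols , p) , q) with twoRows sh
  f∘g {T} ((sh , ri1 ∷ _ , cols , p) , q) | r1 , r2 , refl =
    cong (_∷ r2 ∷ []) (sym (RowsIncr-max-last ri1 (λ x → entry≤size r1 r2 p (∈-++⁺ˡ x)) q))

syt-square₁ : ∀ a T → SYT₂ (suc a) (suc a) T → InRow₁ (suc (a + (suc a + 0))) T → ⊥
syt-square₁ a T (sh , rows , cols , p) q with twoRows sh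
syt-square₁ a T (e1 ∷ (e2 ∷ []) , ri1 ∷ _ , col ∷ [-] , p) q | r1 , r2 , refl =
  <⇒≱ (col (suc a) (s≤s z≤n) (≤-reflexive (sym e2)))
     (subst (_ ≤_) (sym lastN) (entry≤size r1 r2 p (∈-++⁺ʳ r1 (val∈ r2 (suc a) (s≤s z≤n) (≤-reflexive (sym e2))))))
  where
  N = suc (a + (suc a + 0))
  ed : r1 ≡ dropLast r1 ++ [ N ]
  ed = RowsIncr-max-last ri1 (λ x → entry≤size r1 r2 p (∈-++⁺ˡ x)) q
  lastN : val r1 (suc a) ≡ N
  lastN = trans (cong₂ val ed (trans (sym e1) (length-dropLast r1 N ed))) (val-last (dropLast r1) N)

syt-grow₂ : ∀ {a c} → c ≤ a → Bijection (SYT₂ (suc a) c) (λ T → SYT₂ (suc a) (suc c) T × InRow₂ (suc (a + (suc c + 0))) T)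
syt-grow₂ {a} {c} c≤a = record { f = addToRow₂ N ; g = dropFromRow₂ ; f-resp = f-resp ; g-resp = g-resp ; g∘f = g∘f ; f∘g = f∘g }
  where
  s = suc a + (c + 0)
  N = suc (a + (suc c + 0))
  eN : N ≡ suc s
  eN = cong suc (+-suc a (c + 0))
  rng : range (suc a + (suc c + 0)) ≡ range s ++ [ N ]
  rng = trans (cong range eN) (trans (range-suc s) (cong (λ w → range s ++ [ w ]) (sym eN)))
  f-resp : ∀ {T} → SYT₂ (suc a) c T → SYT₂ (suc a) (suc c) (addToRow₂ N T) × InRow₂ N (addToRow₂ N T)
  f-resp {T} (sh , rows , cols , p) with twoRows sh
  f-resp {T} (e1 ∷ (e2 ∷ []) , ri1 ∷ (ri2 ∷ []) , col ∷ [-] , p) | r1 , r2 , refl =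
    (e1 ∷ (trans (length-++ r2) (trans (+-comm (length r2) 1) (cong suc e2)) ∷ []) ,
     ri1 ∷ (RowsIncr-∷ʳ ri2 (All.tabulate (λ {x} q → subst (x <_) (sym eN) (s≤s (entry≤size r1 r2 p (∈-++⁺ʳ r1 q))))) ∷ []) ,
     col' ∷ [-] ,
     ↭-trans (↭-reflexive (trans (concat-twoRows r1 (r2 ++ [ N ])) (sym (++-assoc r1 r2 [ N ]))))
       (↭-trans (↭-++⁺ʳ [ N ] (↭-trans (↭-reflexive (sym (concat-twoRows r1 r2))) p)) (↭-reflexive (sym rng)))) ,
    ∈-++⁺ʳ r2 (here refl)
    where
    col' : (j : ℕ) → 1 ≤ j → j ≤ length (r2 ++ [ N ]) → val r1 j < val (r2 ++ [ N ]) j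
    col' j 1≤j j≤ with m≤n⇒m<n∨m≡n (≤-trans j≤ (≤-reflexive (trans (length-++ r2) (trans (+-comm (length r2) 1) (cong suc e2)))))
    ... | inj₁ (s≤s j≤c) = subst (val r1 j <_) (sym (val-++ˡ r2 [ N ] j (≤-trans j≤c (≤-reflexive (sym e2))))) (col j 1≤j (≤-trans j≤c (≤-reflexive (sym e2))))
    ... | inj₂ refl = subst (val r1 (suc c) <_) (sym (trans (cong (λ w → val (r2 ++ [ N ]) (suc w)) (sym e2)) (val-last r2 N)))
                        (subst (val r1 (suc c) <_) (sym eN) (s≤s (entry≤size r1 r2 p (∈-++⁺ˡ (val∈ r1 (suc c) (s≤s z≤n) (≤-trans (s≤s c≤a) (≤-reflexive (sym e1))))))))
  g-resp : ∀ {T} → SYT₂ (suc a) (suc c) T × InRow₂ N T → SYT₂ (suc a) c (dropFromRow₂ T)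
  g-resp {T} ((sh , rows , cols , p) , q) with twoRows sh
  g-resp {T} ((e1 ∷ (e2 ∷ []) , ri1 ∷ (ri2 ∷ []) , col ∷ [-] , p) , q) | r1 , r2 , refl =
    e1 ∷ (ldl ∷ []) , ri1 ∷ (RowsIncr-dropLast ri2 ∷ []) ,
    (λ j 1≤j j≤ → subst (val r1 j <_)
        (trans (cong (λ w → val w j) ed) (val-++ˡ (dropLast r2) [ N ] j j≤))
        (col j 1≤j (≤-trans j≤ (≤-trans (≤-reflexive ldl) (≤-trans (n≤1+n c) (≤-reflexive (sym e2))))))) ∷ [-] ,
    ↭-trans (↭-reflexive (trans (concat-twoRows r1 (dropLast r2)) (sym (++-identityʳ (r1 ++ dropLast r2)))))
      (subst (λ w → (r1 ++ dropLast r2) ++ [] ↭ w) (++-identityʳ (range s))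
        (drop-mid (r1 ++ dropLast r2) (range s)
          (↭-trans (↭-reflexive (trans (trans (++-assoc r1 (dropLast r2) [ N ]) (cong (r1 ++_) (sym ed))) (sym (concat-twoRows r1 r2))))
            (↭-trans p (↭-reflexive rng)))))
    where
    ed : r2 ≡ dropLast r2 ++ [ N ]
    ed = RowsIncr-max-last ri2 (λ x → entry≤size r1 r2 p (∈-++⁺ʳ r1 x)) q
    ldl : length (dropLast r2) ≡ c
    ldl = suc-injective (trans (sym (length-dropLast r2 N ed)) e2)
  g∘f : ∀ {T} → SYT₂ (suc a) c T → dropFromRow₂ (addToRow₂ N T) ≡ T
  g∘f {T} (sh , _) with twoRows sh
  ... | r1 , r2 , refl = cong (λ w → r1 ∷ w ∷ []) (dropLast-∷ʳ r2 N)
  f∘g : ∀ {T} → SYT₂ (suc a) (suc c) T × InRow₂ N T → addToRow₂ N (dropFromRow₂ T) ≡ T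
  f∘g {T} ((sh , rows , cols , p) , q) with twoRows sh
  f∘g {T} ((sh , _ ∷ (ri2 ∷ []) , cols , p) , q) | r1 , r2 , refl =
    cong (λ w → r1 ∷ w ∷ []) (sym (RowsIncr-max-last ri2 (λ x → entry≤size r1 r2 p (∈-++⁺ʳ r1 x)) q))

syt-flat₂ : ∀ a T → SYT₂ (suc a) 0 T → InRow₂ (suc (a + 0)) T → ⊥
syt-flat₂ a T (sh , rows , cols , p) q with twoRows sh
syt-flat₂ a T (e1 ∷ (e2 ∷ []) , _) q | r1 , [] , refl with q
... | ()
syt-flat₂ a T (e1 ∷ (() ∷ []) , _) q | r1 , (x ∷ r2) , refl

syt-base : HasCard (SYT₂ 0 0) 1
syt-base = HasCard-singleton ([] ∷ [] ∷ []) e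
  where
  t1 : ∀ T → SYT₂ 0 0 T → T ≡ [] ∷ [] ∷ []
  t1 T (sh , _) with twoRows sh
  t1 T (e1 ∷ (e2 ∷ []) , _) | [] , [] , refl = refl
  e : ∀ T → SYT₂ 0 0 T ⇔ (T ≡ [] ∷ [] ∷ [])
  e T = mk⇔ (t1 T) (λ { refl → (refl ∷ (refl ∷ [])) , ([] ∷ ([] ∷ [])) , ((λ { j (s≤s _) () }) ∷ [-]) , ↭-refl })

-- The ballot recurrence

-- Read F a c as the standard Young tableaux of shape (a, c): Last₁ a c and
-- Last₂ a c say that the largest entry of a tableau of shape (suc a, c)
-- lies in the first, resp. second, row.
record BallotFamily {X : Set} (F : ℕ → ℕ → X → Set) : Set₁ where
  field
    Last₁ Last₂ : ℕ → ℕ → X → Set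
    cases       : ∀ a c x → F (suc a) c x → Last₁ a c x ⊎ Last₂ a c x
    disjoint    : ∀ a c x → F (suc a) c x → Last₁ a c x → Last₂ a c x → ⊥
    grow₁       : ∀ {a c} → c ≤ a → Bijection (F a c) (λ x → F (suc a) c x × Last₁ a c x)
    grow₂       : ∀ {a c} → c ≤ a → Bijection (F (suc a) c) (λ x → F (suc a) (suc c) x × Last₂ a (suc c) x)
    square₁     : ∀ a x → F (suc a) (suc a) x → ¬ Last₁ a (suc a) x
    flat₂       : ∀ a x → F (suc a) 0 x → ¬ Last₂ a 0 x
    base        : HasCard (F 0 0) 1

module BallotRecurrence {X : Set} {F : ℕ → ℕ → X → Set} (𝔽 : BallotFamily F) where
  open BallotFamily 𝔽

  card-flat : ∀ {a m} → HasCard (F a 0) m → HasCard (F (suc a) 0) (m + 0)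
  card-flat {a} h = HasCard-split (HasCard-resp-Bijection (grow₁ z≤n) h)
    (HasCard-empty (λ x p → flat₂ a x (proj₁ p) (proj₂ p))) (cases a 0) (disjoint a 0)

  card-inner : ∀ {a c m₁ m₂} → c < a → HasCard (F a (suc c)) m₁ → HasCard (F (suc a) c) m₂ →
               HasCard (F (suc a) (suc c)) (m₁ + m₂)
  card-inner {a} {c} c<a h₁ h₂ = HasCard-split (HasCard-resp-Bijection (grow₁ c<a) h₁)
    (HasCard-resp-Bijection (grow₂ (<⇒≤ c<a)) h₂) (cases a (suc c)) (disjoint a (suc c))

  card-square : ∀ {a m} → HasCard (F (suc a) a) m → HasCard (F (suc a) (suc a)) (0 + m)
  card-square {a} h = HasCard-split (HasCard-empty (λ x p → square₁ a x (proj₁ p) (proj₂ p)))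
    (HasCard-resp-Bijection (grow₂ ≤-refl) h) (cases a (suc a)) (disjoint a (suc a))

ballot-equinumerous : ∀ {X Y : Set} {F : ℕ → ℕ → X → Set} {G : ℕ → ℕ → Y → Set} →
                      BallotFamily F → BallotFamily G →
                      ∀ {a c} → c ≤ a → ∃[ m ] HasCard (F a c) m × HasCard (G a c) m
ballot-equinumerous {F = F} {G} 𝔽 𝔾 = go
  where
  module 𝔽 = BallotRecurrence 𝔽
  module 𝔾 = BallotRecurrence 𝔾
  go : ∀ {a c} → c ≤ a → ∃[ m ] HasCard (F a c) m × HasCard (G a c) m
  go {zero} {zero} z≤n = 1 , BallotFamily.base 𝔽 , BallotFamily.base 𝔾
  go {suc a} {zero} _ with go {a} {0} z≤n
  ... | m , hF , hG = m + 0 , 𝔽.card-flat hF , 𝔾.card-flat hG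
  go {suc a} {suc c} (s≤s c≤a) with go {suc a} {c} (m≤n⇒m≤1+n c≤a) | m≤n⇒m<n∨m≡n c≤a
  ... | m₂ , hF₂ , hG₂ | inj₂ refl = 0 + m₂ , 𝔽.card-square hF₂ , 𝔾.card-square hG₂
  ... | m₂ , hF₂ , hG₂ | inj₁ c<a with go {a} {suc c} c<a
  ...   | m₁ , hF₁ , hG₁ = m₁ + m₂ , 𝔽.card-inner c<a hF₁ hF₂ , 𝔾.card-inner c<a hG₁ hG₂

ballot-transfer : ∀ {X Y : Set} {F : ℕ → ℕ → X → Set} {G : ℕ → ℕ → Y → Set} →
                  BallotFamily F → BallotFamily G →
                  ∀ {a c m} → c ≤ a → HasCard (F a c) m → HasCard (G a c) m
ballot-transfer 𝔽 𝔾 c≤a h with ballot-equinumerous 𝔽 𝔾 c≤a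
... | m , hF , hG = subst (HasCard _) (HasCard-unique hF h) hG

catalanZerosFamily : BallotFamily CatalanZeros
catalanZerosFamily = record
  { Last₁ = λ _ _ → SecondIsZero ; Last₂ = λ _ _ → SecondIsOne
  ; cases = catalanZeros-cases ; disjoint = λ _ _ d _ → catalanZeros-disjoint d
  ; grow₁ = catalanZeros-grow₁ ; grow₂ = catalanZeros-grow₂
  ; square₁ = catalanZeros-square₁ ; flat₂ = catalanZeros-flat₂ ; base = catalanZeros-base }

revCatalanHeadFamily : BallotFamily RevCatalanHead
revCatalanHeadFamily = record
  { Last₁ = λ _ _ → HeadRises ; Last₂ = λ _ _ → HeadNotRising
  ; cases = revCatalan-cases ; disjoint = λ _ _ r _ → revCatalan-disjoint r
  ; grow₁ = revCatalan-grow₁ ; grow₂ = revCatalan-grow₂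
  ; square₁ = revCatalan-square₁ ; flat₂ = revCatalan-flat₂ ; base = revCatalan-base }

sytFamily : BallotFamily SYT₂
sytFamily = record
  { Last₁ = λ a c → InRow₁ (suc (a + (c + 0))) ; Last₂ = λ a c → InRow₂ (suc (a + (c + 0)))
  ; cases = syt-cases ; disjoint = syt-disjoint
  ; grow₁ = syt-grow₁ ; grow₂ = syt-grow₂
  ; square₁ = syt-square₁ ; flat₂ = syt-flat₂ ; base = syt-base }

-- Positions, 321-patterns and the last descent

at : List ℕ → ℕ → ℕ
at xs i = val xs (suc i)

at-++ˡ : ∀ (xs ys : List ℕ) i → i < length xs → at (xs ++ ys) i ≡ at xs i
at-++ˡ (x ∷ xs) ys zero _ = refl
at-++ˡ (x ∷ xs) ys (suc i) (s≤s lt) = at-++ˡ xs ys i lt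

at-++ʳ : ∀ (xs ys : List ℕ) i → at (xs ++ ys) (length xs + i) ≡ at ys i
at-++ʳ [] ys i = refl
at-++ʳ (x ∷ xs) ys i = at-++ʳ xs ys i

at∈ : ∀ (xs : List ℕ) i → i < length xs → at xs i ∈ xs
at∈ (x ∷ xs) zero _ = here refl
at∈ (x ∷ xs) (suc i) (s≤s lt) = there (at∈ xs i lt)

∈-at : ∀ {xs : List ℕ} {x} → x ∈ xs → ∃ λ i → i < length xs × at xs i ≡ x
∈-at (here refl) = 0 , s≤s z≤n , refl
∈-at (there p) with ∈-at p
... | i , lt , e = suc i , s≤s lt , e

at-map : ∀ (f : ℕ → ℕ) (xs : List ℕ) i → i < length xs → at (map f xs) i ≡ f (at xs i)
at-map f (x ∷ xs) zero _ = refl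
at-map f (x ∷ xs) (suc i) (s≤s lt) = at-map f xs i lt

at-injective : ∀ {xs : List ℕ} i j → Unique xs → i < length xs → j < length xs → at xs i ≡ at xs j → i ≡ j
at-injective {x ∷ xs} zero zero u _ _ _ = refl
at-injective {x ∷ xs} zero (suc j) (a ∷ u) _ (s≤s lt) e = ⊥-elim (All.lookup a (at∈ xs j lt) e)
at-injective {x ∷ xs} (suc i) zero (a ∷ u) (s≤s lt) _ e = ⊥-elim (All.lookup a (at∈ xs i lt) (sym e))
at-injective {x ∷ xs} (suc i) (suc j) (_ ∷ u) (s≤s l1) (s≤s l2) e = cong suc (at-injective i j u l1 l2 e)

at-ext : ∀ (xs ys : List ℕ) → length xs ≡ length ys → (∀ i → i < length xs → at xs i ≡ at ys i) → xs ≡ ys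
at-ext [] [] _ _ = refl
at-ext (x ∷ xs) (y ∷ ys) l h = cong₂ _∷_ (h 0 (s≤s z≤n)) (at-ext xs ys (suc-injective l) (λ i lt → h (suc i) (s≤s lt)))

at-take : ∀ (xs : List ℕ) q i → i < q → at (take q xs) i ≡ at xs i
at-take [] zero i lt = refl
at-take [] (suc q) i lt = refl
at-take (x ∷ xs) (suc q) zero lt = refl
at-take (x ∷ xs) (suc q) (suc i) (s≤s lt) = at-take xs q i lt

at-drop : ∀ (xs : List ℕ) q i → at (drop q xs) i ≡ at xs (q + i)
at-drop xs zero i = refl
at-drop [] (suc q) i = refl
at-drop (x ∷ xs) (suc q) i = at-drop xs q i

length-take≤ : ∀ (xs : List ℕ) q → q ≤ length xs → length (take q xs) ≡ q
length-take≤ xs q q≤ = trans (length-take q xs) (m≤n⇒m⊓n≡m q≤)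

Has321 : List ℕ → Set
Has321 π = ∃ λ i → ∃ λ j → ∃ λ l → i < j × j < l × l < length π × at π j < at π i × at π l < at π j

Avoids321⇒¬Has321 : ∀ {π} → Avoids321 π → ¬ Has321 π
Avoids321⇒¬Has321 av (i , j , l , ij , jl , ll , v1 , v2) = av (suc i , suc j , suc l , s≤s z≤n , s≤s ij , s≤s jl , ll , v1 , v2)

¬Has321⇒Avoids321 : ∀ {π} → ¬ Has321 π → Avoids321 π
¬Has321⇒Avoids321 np (suc i , suc j , suc l , _ , s≤s ij , s≤s jl , ll , v1 , v2) = np (i , j , l , ij , jl , ll , v1 , v2)
¬Has321⇒Avoids321 np (suc i , zero , l , _ , () , _)
¬Has321⇒Avoids321 np (suc i , suc j , zero , _ , _ , () , _)

DescentAt : List ℕ → ℕ → Set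
DescentAt π i = at π (suc i) < at π i

max⁺ : List ℕ → ℕ
max⁺ = foldr _⊔_ 0

≤-max⁺ : ∀ {xs x} → x ∈ xs → x ≤ max⁺ xs
≤-max⁺ {y ∷ xs} (here refl) = m≤m⊔n y (max⁺ xs)
≤-max⁺ {y ∷ xs} (there p) = ≤-trans (≤-max⁺ p) (m≤n⊔m y (max⁺ xs))

max⁺-∈ : ∀ xs → max⁺ xs ≡ 0 ⊎ max⁺ xs ∈ xs
max⁺-∈ [] = inj₁ refl
max⁺-∈ (y ∷ xs) with ⊔-sel y (max⁺ xs)
... | inj₁ e = inj₂ (subst (_∈ y ∷ xs) (sym e) (here refl))
... | inj₂ e with max⁺-∈ xs
...   | inj₁ z = inj₁ (trans e z)
...   | inj₂ m = inj₂ (subst (_∈ y ∷ xs) (sym e) (there m))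

≤∸1⇒suc< : ∀ n i → suc i ≤ n ∸ 1 → suc (suc i) ≤ n
≤∸1⇒suc< (suc n) i le = s≤s le

suc<⇒≤∸1 : ∀ n i → suc (suc i) ≤ n → suc i ≤ n ∸ 1
suc<⇒≤∸1 (suc n) i (s≤s le) = le

ldes-≥ : ∀ π i → DescentAt π i → suc (suc i) ≤ length π → suc i ≤ ldes π
ldes-≥ π i d le = ≤-max⁺ (∈-filter⁺ (λ i → val π (suc i) <? val π i)
   (∈-range⁺ (s≤s z≤n) (suc<⇒≤∸1 (length π) i le)) d)

ldes-view : ∀ π → ldes π ≡ 0 ⊎ Σ ℕ λ i → ldes π ≡ suc i × DescentAt π i × suc (suc i) ≤ length π
ldes-view π with max⁺-∈ (filter (λ i → val π (suc i) <? val π i) (range (length π ∸ 1)))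
... | inj₁ z = inj₁ z
... | inj₂ m with ∈-filter⁻ (λ i → val π (suc i) <? val π i) m
...   | r , d = h (ldes π) refl r d
  where
  h : ∀ x → x ≡ ldes π → x ∈ range (length π ∸ 1) → val π (suc x) < val π x →
      ldes π ≡ 0 ⊎ Σ ℕ λ i → ldes π ≡ suc i × DescentAt π i × suc (suc i) ≤ length π
  h x e r d with ∈-range⁻ r
  h (suc i) e r d | _ , le = inj₂ (i , sym e , d , ≤∸1⇒suc< (length π) i le)

ldes-≤ : ∀ π b → (∀ i → DescentAt π i → suc (suc i) ≤ length π → suc i ≤ b) → ldes π ≤ b
ldes-≤ π b h with ldes-view π
... | inj₁ z = subst (_≤ b) (sym z) z≤n
... | inj₂ (i , e , d , le) = subst (_≤ b) (sym e) (h i d le)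

ldes-unique : ∀ π L → (L ≡ 0 ⊎ Σ ℕ λ i → L ≡ suc i × DescentAt π i × suc (suc i) ≤ length π) →
          (∀ i → DescentAt π i → suc (suc i) ≤ length π → suc i ≤ L) → ldes π ≡ L
ldes-unique π L c h = ≤-antisym (ldes-≤ π L h) (lo c)
  where
  lo : (L ≡ 0 ⊎ Σ ℕ λ i → L ≡ suc i × DescentAt π i × suc (suc i) ≤ length π) → L ≤ ldes π
  lo (inj₁ refl) = z≤n
  lo (inj₂ (i , refl , d , le)) = ldes-≥ π i d le

ldes≤length∸1 : ∀ π → ldes π ≤ length π ∸ 1
ldes≤length∸1 π = ldes-≤ π (length π ∸ 1) (λ i _ le → suc<⇒≤∸1 (length π) i le)

-- Inserting the maximum

data Around (q t : ℕ) : Set where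
  ilt : t < q → Around q t
  ieq : t ≡ q → Around q t
  igt : ∀ k → t ≡ q + suc k → Around q t

around : ∀ q t → Around q t
around q t with <-cmp t q
... | tri< a _ _ = ilt a
... | tri≈ _ b _ = ieq b
... | tri> _ _ c = igt (t ∸ suc q) (sym (trans (+-suc q (t ∸ suc q)) (m+[n∸m]≡n c)))

data Side (q s : ℕ) : Set where
  slt : s < q → Side q s
  sge : ∀ k → s ≡ q + k → Side q s

side : ∀ q s → Side q s
side q s with s <? q
... | yes a = slt a
... | no b = sge (s ∸ q) (sym (m+[n∸m]≡n (≮⇒≥ b)))

Increasing : List ℕ → Set
Increasing ys = ∀ j l → j < l → l < length ys → at ys j < at ys l

module Insertion (xs ys : List ℕ) (m : ℕ) where
  π σ : List ℕ
  π = xs ++ m ∷ ys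
  σ = xs ++ ys
  q = length xs

  lenπ : length π ≡ suc (length σ)
  lenπ = trans (length-++ xs) (trans (+-suc (length xs) (length ys)) (cong suc (sym (length-++ xs))))

  πlt : ∀ t → t < q → at π t ≡ at xs t
  πlt t lt = at-++ˡ xs (m ∷ ys) t lt
  πeq : at π q ≡ m
  πeq = trans (cong (at π) (sym (+-identityʳ q))) (at-++ʳ xs (m ∷ ys) 0)
  πgt : ∀ k → at π (q + suc k) ≡ at ys k
  πgt k = at-++ʳ xs (m ∷ ys) (suc k)
  σlt : ∀ t → t < q → at σ t ≡ at xs t
  σlt t lt = at-++ˡ xs ys t lt
  σge : ∀ k → at σ (q + k) ≡ at ys k
  σge k = at-++ʳ xs ys k

  kbound : ∀ {t k} → t ≡ q + suc k → t < length π → k < length ys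
  kbound {t} {k} refl lt = s<s⁻¹ (+-cancelˡ-< q (suc k) (suc (length ys)) (≤-trans lt (≤-reflexive (length-++ xs))))

  xs∈σ : ∀ t → t < q → at xs t ∈ σ
  xs∈σ t lt = ∈-++⁺ˡ (at∈ xs t lt)
  ys∈σ : ∀ k → k < length ys → at ys k ∈ σ
  ys∈σ k lt = ∈-++⁺ʳ xs (at∈ ys k lt)

  lenσ : length σ ≡ q + length ys
  lenσ = length-++ xs

  -- A 321-pattern of π either misses position q, and is then one of σ, or uses
  -- the maximum m there as its largest entry, and then its two smaller entries
  -- form a descent in the increasing suffix ys.
  insert-avoids : ¬ Has321 σ → Increasing ys → (∀ {x} → x ∈ σ → x < m) → ¬ Has321 π
  insert-avoids np inc bd (i , j , l , ij , jl , ll , vj , vl) with around q i | around q j | around q l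
  ... | ieq refl | igt kj refl | igt kl refl =
        <-asym vl' (inc kj kl (+-cancelˡ-< q kj kl (s<s⁻¹ (subst₂ _<_ (+-suc q kj) (+-suc q kl) jl))) (kbound refl ll))
    where vl' : at ys kl < at ys kj
          vl' = subst₂ _<_ (πgt kl) (πgt kj) vl
  ... | ieq refl | ieq refl | _ = <-irrefl refl ij
  ... | ieq refl | ilt a | _ = <-asym a ij
  ... | ieq refl | igt kj refl | ieq e = <-irrefl (sym e) (<-trans ij jl)
  ... | ieq refl | igt kj refl | ilt a = <-asym a (<-trans ij jl)
  ... | igt ki refl | igt kj refl | igt kl refl =
        np (q + ki , q + kj , q + kl , (s<s⁻¹ (subst₂ _<_ (+-suc q ki) (+-suc q kj) ij)) ,
            (s<s⁻¹ (subst₂ _<_ (+-suc q kj) (+-suc q kl) jl)) ,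
            subst (_ <_) (sym lenσ) (+-monoʳ-< q (kbound refl ll)) ,
            subst₂ _<_ (trans (πgt kj) (sym (σge kj))) (trans (πgt ki) (sym (σge ki))) vj ,
            subst₂ _<_ (trans (πgt kl) (sym (σge kl))) (trans (πgt kj) (sym (σge kj))) vl)
  ... | igt ki refl | ilt a | _ = <-asym (<-trans (≤-trans (s≤s (m≤m+n q ki)) (≤-reflexive (sym (+-suc q ki)))) ij) a
  ... | igt ki refl | ieq e | _ = <-asym (subst (q + suc ki <_) e ij) (≤-trans (s≤s (m≤m+n q ki)) (≤-reflexive (sym (+-suc q ki))))
  ... | igt ki refl | igt kj refl | ilt a = <-asym (<-trans ij (<-trans jl a)) (≤-trans (s≤s (m≤m+n q ki)) (≤-reflexive (sym (+-suc q ki))))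
  ... | igt ki refl | igt kj refl | ieq e = <-asym (subst (_ <_) e (<-trans ij jl)) (≤-trans (s≤s (m≤m+n q ki)) (≤-reflexive (sym (+-suc q ki))))
  ... | ilt a | ieq refl | _ = <-asym (subst₂ _<_ πeq (πlt i a) vj) (bd (xs∈σ i a))
  ... | ilt a | ilt b | ieq refl = <-asym (subst₂ _<_ πeq (πlt j b) vl) (bd (xs∈σ j b))
  ... | ilt a | ilt b | ilt c =
        np (i , j , l , ij , jl , <-≤-trans c (≤-trans (m≤m+n q (length ys)) (≤-reflexive (sym lenσ))) ,
            subst₂ _<_ (trans (πlt j b) (sym (σlt j b))) (trans (πlt i a) (sym (σlt i a))) vj ,
            subst₂ _<_ (trans (πlt l c) (sym (σlt l c))) (trans (πlt j b) (sym (σlt j b))) vl)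
  ... | ilt a | ilt b | igt kl refl =
        np (i , j , q + kl , ij , <-≤-trans b (m≤m+n q kl) ,
            subst (_ <_) (sym lenσ) (+-monoʳ-< q (kbound refl ll)) ,
            subst₂ _<_ (trans (πlt j b) (sym (σlt j b))) (trans (πlt i a) (sym (σlt i a))) vj ,
            subst₂ _<_ (trans (πgt kl) (sym (σge kl))) (trans (πlt j b) (sym (σlt j b))) vl)
  ... | ilt a | igt kj refl | ilt c = <-asym (<-trans jl c) (≤-trans (s≤s (m≤m+n q kj)) (≤-reflexive (sym (+-suc q kj))))
  ... | ilt a | igt kj refl | ieq e = <-asym (subst (_ <_) e jl) (≤-trans (s≤s (m≤m+n q kj)) (≤-reflexive (sym (+-suc q kj))))
  ... | ilt a | igt kj refl | igt kl refl =
        np (i , q + kj , q + kl , <-≤-trans a (m≤m+n q kj) ,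
            (s<s⁻¹ (subst₂ _<_ (+-suc q kj) (+-suc q kl) jl)) ,
            subst (_ <_) (sym lenσ) (+-monoʳ-< q (kbound refl ll)) ,
            subst₂ _<_ (trans (πgt kj) (sym (σge kj))) (trans (πlt i a) (sym (σlt i a))) vj ,
            subst₂ _<_ (trans (πgt kl) (sym (σge kl))) (trans (πgt kj) (sym (σge kj))) vl)

  embedIndex : ∀ s → Side q s → ℕ
  embedIndex s (slt _) = s
  embedIndex s (sge k _) = q + suc k

  at-embedIndex : ∀ s v → at π (embedIndex s v) ≡ at σ s
  at-embedIndex s (slt a) = trans (πlt s a) (sym (σlt s a))
  at-embedIndex s (sge k refl) = trans (πgt k) (sym (σge k))

  qlt : ∀ k → q < q + suc k
  qlt k = ≤-trans (s≤s (m≤m+n q k)) (≤-reflexive (sym (+-suc q k)))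

  embedIndex-mono : ∀ s t v w → s < t → embedIndex s v < embedIndex t w
  embedIndex-mono s t (slt a) (slt b) lt = lt
  embedIndex-mono s t (slt a) (sge k _) lt = <-trans a (qlt k)
  embedIndex-mono s t (sge k refl) (slt b) lt = ⊥-elim (<⇒≱ (<-trans lt b) (m≤m+n q k))
  embedIndex-mono s t (sge k refl) (sge k' refl) lt = subst₂ _<_ (sym (+-suc q k)) (sym (+-suc q k')) (s≤s lt)

  embedIndex-bound : ∀ s v → s < length σ → embedIndex s v < length π
  embedIndex-bound s (slt a) lt = <-trans a (≤-trans (s≤s (m≤m+n q (length ys))) (≤-reflexive (sym (trans (length-++ xs) (+-suc q (length ys))))))
  embedIndex-bound s (sge k refl) lt =
    ≤-trans (≤-reflexive (cong suc (+-suc q k)))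
      (≤-trans (s≤s (≤-trans lt (≤-reflexive lenσ))) (≤-reflexive (sym (trans (length-++ xs) (+-suc q (length ys))))))

  delete-avoids : ¬ Has321 π → ¬ Has321 σ
  delete-avoids np (i , j , l , ij , jl , ll , vj , vl) =
    np (embedIndex i vi , embedIndex j vj' , embedIndex l vl' , embedIndex-mono i j vi vj' ij , embedIndex-mono j l vj' vl' jl , embedIndex-bound l vl' ll ,
        subst₂ _<_ (sym (at-embedIndex j vj')) (sym (at-embedIndex i vi)) vj ,
        subst₂ _<_ (sym (at-embedIndex l vl')) (sym (at-embedIndex j vj')) vl)
    where
    vi = side q i
    vj' = side q j
    vl' = side q l

  adjacent⇒Increasing : ∀ (f : ℕ → ℕ) → (∀ k → suc k < length ys → f k < f (suc k)) → ∀ j l → j < l → l < length ys → f j < f l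
  adjacent⇒Increasing f adj j (suc l) (s≤s jl) ll with m≤n⇒m<n∨m≡n jl
  ... | inj₂ refl = adj j ll
  ... | inj₁ lt = <-trans (adjacent⇒Increasing f adj j l lt (<-trans (n<1+n l) ll)) (adj l ll)

  avoids⇒suffix-Increasing : ¬ Has321 π → Unique σ → (∀ {x} → x ∈ σ → x < m) → Increasing ys
  avoids⇒suffix-Increasing np u bd = adjacent⇒Increasing (at ys) adj
    where
    adj : ∀ k → suc k < length ys → at ys k < at ys (suc k)
    adj k lt with <-cmp (at ys k) (at ys (suc k))
    ... | tri< a _ _ = a
    ... | tri≈ _ b _ = ⊥-elim (1+n≢n (sym (+-cancelˡ-≡ q k (suc k)
            (at-injective (q + k) (q + suc k) u
               (subst (_ <_) (sym lenσ) (+-monoʳ-< q (<-trans (n<1+n k) lt)))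
               (subst (_ <_) (sym lenσ) (+-monoʳ-< q lt))
               (trans (σge k) (trans b (sym (σge (suc k)))))))))
    ... | tri> _ _ c = ⊥-elim (np (q , q + suc k , q + suc (suc k) , qlt k ,
            subst₂ _<_ (sym (+-suc q k)) (sym (+-suc q (suc k))) (s≤s (+-monoʳ-< q (n<1+n k))) ,
            ≤-trans (+-monoʳ-< q (s≤s lt)) (≤-reflexive (sym (length-++ xs))) ,
            subst₂ _<_ (sym (πgt k)) (sym πeq) (bd (ys∈σ k (<-trans (n<1+n k) lt))) ,
            subst₂ _<_ (sym (πgt (suc k))) (sym (πgt k)) c))

  suffix-Increasing⇒ldes≤ : Increasing ys → ldes σ ≤ q
  suffix-Increasing⇒ldes≤ inc = ldes-≤ σ q h
    where
    h : ∀ i → DescentAt σ i → suc (suc i) ≤ length σ → suc i ≤ q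
    h i d le with side q i
    ... | slt a = a
    ... | sge k refl = ⊥-elim (<-asym d (subst₂ _<_ (sym (σge k)) (trans (sym (σge (suc k))) (cong (at σ) (+-suc q k)))
            (inc k (suc k) (n<1+n k) (+-cancelˡ-< q (suc k) (length ys)
               (≤-trans (≤-reflexive (cong suc (+-suc q k))) (≤-trans le (≤-reflexive lenσ)))))))

  ldes≤⇒suffix-Increasing : Unique σ → ldes σ ≤ q → Increasing ys
  ldes≤⇒suffix-Increasing u le = adjacent⇒Increasing (at ys) adj
    where
    adj : ∀ k → suc k < length ys → at ys k < at ys (suc k)
    adj k lt with <-cmp (at ys k) (at ys (suc k))
    ... | tri< a _ _ = a
    ... | tri≈ _ b _ = ⊥-elim (1+n≢n (sym (+-cancelˡ-≡ q k (suc k)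
            (at-injective (q + k) (q + suc k) u
               (subst (_ <_) (sym lenσ) (+-monoʳ-< q (<-trans (n<1+n k) lt)))
               (subst (_ <_) (sym lenσ) (+-monoʳ-< q lt))
               (trans (σge k) (trans b (sym (σge (suc k)))))))))
    ... | tri> _ _ c = ⊥-elim (1+n≰n (≤-trans (s≤s (m≤m+n q k))
            (≤-trans (ldes-≥ σ (q + k) (subst₂ _<_ (trans (sym (σge (suc k))) (cong (at σ) (+-suc q k))) (sym (σge k)) c)
               (≤-trans (≤-reflexive (trans (cong suc (sym (+-suc q k))) (sym (+-suc q (suc k))))) (≤-trans (+-monoʳ-≤ q lt) (≤-reflexive (sym lenσ))))) le)))

  ldes-insert-before : ∀ y ys' → ys ≡ y ∷ ys' → Increasing ys → (∀ {x} → x ∈ σ → x < m) → ldes π ≡ suc q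
  ldes-insert-before y ys' refl inc bd = ldes-unique π (suc q)
    (inj₂ (q , refl , subst₂ _<_ (sym (trans (cong (at π) (sym (+-comm q 1))) (πgt 0))) (sym πeq) (bd (ys∈σ 0 (s≤s z≤n))) ,
           ≤-trans (s≤s (≤-trans (s≤s (m≤m+n q (length ys'))) (≤-reflexive (sym (+-suc q (length ys'))))))
                   (≤-reflexive (sym (trans (length-++ xs) (+-suc q (suc (length ys'))))))))
    h
    where
    h : ∀ i → DescentAt π i → suc (suc i) ≤ length π → suc i ≤ suc q
    h i d le with around q i
    ... | ilt a = s≤s (<⇒≤ a)
    ... | ieq refl = ≤-refl
    ... | igt k refl = ⊥-elim (<-asym d (subst₂ _<_ (sym (πgt k)) (trans (sym (πgt (suc k))) (cong (at π) (+-suc q (suc k))))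
            (inc k (suc k) (n<1+n k) (s<s⁻¹ (+-cancelˡ-< q (suc (suc k)) (suc (length ys))
               (≤-trans (≤-reflexive (cong suc (+-suc q (suc k)))) (≤-trans le (≤-reflexive (length-++ xs)))))))))

  ldes-insert-last : ys ≡ [] → (∀ {x} → x ∈ σ → x < m) → ldes π ≡ ldes xs
  ldes-insert-last refl bd = ldes-unique π (ldes xs) c h
    where
    lenπ' : length π ≡ suc q
    lenπ' = trans (length-++ xs) (+-comm q 1)
    c : ldes xs ≡ 0 ⊎ Σ ℕ λ i → ldes xs ≡ suc i × DescentAt π i × suc (suc i) ≤ length π
    c with ldes-view xs
    ... | inj₁ z = inj₁ z
    ... | inj₂ (i , e , d , le) = inj₂ (i , e ,
           subst₂ _<_ (sym (πlt (suc i) le)) (sym (πlt i (<-trans (n<1+n i) le))) d ,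
           ≤-trans le (≤-trans (n≤1+n q) (≤-reflexive (sym lenπ'))))
    h : ∀ i → DescentAt π i → suc (suc i) ≤ length π → suc i ≤ ldes xs
    h i d le with m≤n⇒m<n∨m≡n (s≤s⁻¹ (≤-trans le (≤-reflexive lenπ')))
    ... | inj₁ lt = ldes-≥ xs i (subst₂ _<_ (πlt (suc i) lt) (πlt i (<-trans (n<1+n i) lt)) d) lt
    ... | inj₂ e = ⊥-elim (<-asym d (subst₂ _<_ (sym (πlt i (subst (i <_) e (n<1+n i)))) (sym (trans (cong (at π) e) πeq))
                     (bd (xs∈σ i (subst (i <_) e (n<1+n i))))))

Av : ℕ → List ℕ → Set
Av n π = IsPerm n π × Avoids321 π

insertAt : ℕ → ℕ → List ℕ → List ℕ
insertAt q m σ = take q σ ++ m ∷ drop q σ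

remove : ℕ → List ℕ → List ℕ
remove m [] = []
remove m (x ∷ xs) with x ≟ m
... | yes _ = xs
... | no _ = x ∷ remove m xs

remove-middle : ∀ m (xs ys : List ℕ) → m ∉ xs → remove m (xs ++ m ∷ ys) ≡ xs ++ ys
remove-middle m [] ys _ with m ≟ m
... | yes _ = refl
... | no ne = ⊥-elim (ne refl)
remove-middle m (x ∷ xs) ys nm with x ≟ m
... | yes refl = ⊥-elim (nm (here refl))
... | no _ = cong (x ∷_) (remove-middle m xs ys (λ p → nm (there p)))

take-++ : ∀ (xs ys : List ℕ) → take (length xs) (xs ++ ys) ≡ xs
take-++ [] ys = refl
take-++ (x ∷ xs) ys = cong (x ∷_) (take-++ xs ys)

drop-++ : ∀ (xs ys : List ℕ) → drop (length xs) (xs ++ ys) ≡ ys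
drop-++ [] ys = refl
drop-++ (x ∷ xs) ys = drop-++ xs ys

insertAt-split : ∀ m (xs ys : List ℕ) → insertAt (length xs) m (xs ++ ys) ≡ xs ++ m ∷ ys
insertAt-split m xs ys = cong₂ (λ a b → a ++ m ∷ b) (take-++ xs ys) (drop-++ xs ys)

range-suc↭ : ∀ n → range (suc n) ↭ suc n ∷ range n
range-suc↭ n = ↭-trans (↭-reflexive (range-suc n)) (++-comm (range n) [ suc n ])

IsPerm-insertMax : ∀ {n} (xs ys : List ℕ) → IsPerm n (xs ++ ys) → IsPerm (suc n) (xs ++ suc n ∷ ys)
IsPerm-insertMax {n} xs ys p = ↭-trans (shift (suc n) xs ys) (↭-trans (prep (suc n) p) (↭-sym (range-suc↭ n)))

IsPerm-deleteMax : ∀ {n} (xs ys : List ℕ) → IsPerm (suc n) (xs ++ suc n ∷ ys) → IsPerm n (xs ++ ys)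
IsPerm-deleteMax {n} xs ys p = subst (λ w → xs ++ ys ↭ w) (++-identityʳ (range n))
  (drop-mid xs (range n) (↭-trans p (↭-reflexive (range-suc n))))

Avoids321-[] : Avoids321 []
Avoids321-[] (i , j , zero , a , ij , () , _)
Avoids321-[] (i , j , suc l , a , ij , jl , () , _)

∈-IsPerm⇒< : ∀ {n π x} → IsPerm n π → x ∈ π → x < suc n
∈-IsPerm⇒< p q = s≤s (proj₂ (∈-IsPerm⁻ p q))

record MaxInsertion (n q : ℕ) (σ : List ℕ) : Set where
  field
    insert-Av : Av (suc n) (insertAt q (suc n) σ)
    remove-insert : remove (suc n) (insertAt q (suc n) σ) ≡ σ
    ldes-at-end : q ≡ n → ldes (insertAt q (suc n) σ) ≡ ldes σ
    ldes-inside : q < n → ldes (insertAt q (suc n) σ) ≡ suc q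

insertMax : ∀ {n q σ} → Av n σ → q ≤ n → ldes σ ≤ q → MaxInsertion n q σ
insertMax {n} {q} {σ} (p , av) q≤n ld = record
  { insert-Av =
      (IsPerm-insertMax xs ys p' , ¬Has321⇒Avoids321 {xs ++ suc n ∷ ys} (I.insert-avoids (subst (λ w → ¬ Has321 w) (sym tde) (Avoids321⇒¬Has321 {σ} av)) inc bd))
  ; remove-insert = trans (remove-middle (suc n) xs ys nm) tde
  ; ldes-at-end = ldes-at-end
  ; ldes-inside = ldes-inside }
  where
  xs = take q σ
  ys = drop q σ
  tde : xs ++ ys ≡ σ
  tde = take++drop≡id q σ
  lσ : length σ ≡ n
  lσ = IsPerm⇒length p
  lxs : length xs ≡ q
  lxs = length-take≤ σ q (≤-trans q≤n (≤-reflexive (sym lσ)))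
  p' : IsPerm n (xs ++ ys)
  p' = subst (IsPerm n) (sym tde) p
  module I = Insertion xs ys (suc n)
  bd : ∀ {x} → x ∈ xs ++ ys → x < suc n
  bd q' = ∈-IsPerm⇒< p' q'
  nm : suc n ∉ xs
  nm q' = <-irrefl refl (bd (∈-++⁺ˡ q'))
  inc : Increasing ys
  inc = I.ldes≤⇒suffix-Increasing (IsPerm⇒Unique p') (subst₂ _≤_ (cong ldes (sym tde)) (sym lxs) ld)
  ldes-at-end : q ≡ n → ldes (insertAt q (suc n) σ) ≡ ldes σ
  ldes-at-end refl = trans (I.ldes-insert-last ysnil bd) (cong ldes (trans (sym (++-identityʳ xs)) (trans (cong (xs ++_) (sym ysnil)) tde)))
    where
    ysnil : ys ≡ []
    ysnil = drop-all q σ (≤-reflexive lσ)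
  ldes-inside : q < n → ldes (insertAt q (suc n) σ) ≡ suc q
  ldes-inside lt = go ys refl
    where
    go : (w : List ℕ) → ys ≡ w → ldes (insertAt q (suc n) σ) ≡ suc q
    go [] e = ⊥-elim (<-irrefl refl (≤-trans lt (≤-reflexive (trans (sym lσ) (trans (cong length (sym tde))
          (trans (length-++ xs) (trans (cong (length xs +_) (cong length e)) (trans (+-identityʳ _) lxs))))))))
    go (y ∷ ys') e = trans (I.ldes-insert-before y ys' e inc bd) (cong suc lxs)

record MaxDeletion (n : ℕ) (π : List ℕ) : Set where
  field
    σ : List ℕ
    q : ℕ
    σ-Av : Av n σ
    q≤n : q ≤ n
    ldes≤q : ldes σ ≤ q
    π≡insert : π ≡ insertAt q (suc n) σ
    remove-π : remove (suc n) π ≡ σ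

deleteMax : ∀ {n π} → Av (suc n) π → MaxDeletion n π
deleteMax {n} {π} (p , av) with ∈-∃++ (∈-IsPerm⁺ p (s≤s z≤n) ≤-refl)
... | xs , ys , refl = record
  { σ = xs ++ ys ; q = length xs ; σ-Av = p' , ¬Has321⇒Avoids321 {xs ++ ys} (I.delete-avoids np)
  ; q≤n = ≤-trans (≤-trans (m≤m+n (length xs) (length ys)) (≤-reflexive (sym (length-++ xs)))) (≤-reflexive (IsPerm⇒length p'))
  ; ldes≤q = I.suffix-Increasing⇒ldes≤ (I.avoids⇒suffix-Increasing np (IsPerm⇒Unique p') (λ q → ∈-IsPerm⇒< p' q))
  ; π≡insert = sym (insertAt-split (suc n) xs ys)
  ; remove-π = remove-middle (suc n) xs ys nm }
  where
  module I = Insertion xs ys (suc n)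
  p' : IsPerm n (xs ++ ys)
  p' = IsPerm-deleteMax xs ys p
  np : ¬ Has321 (xs ++ suc n ∷ ys)
  np = Avoids321⇒¬Has321 {xs ++ suc n ∷ ys} av
  nm : suc n ∉ xs
  nm q = Unique-++-disjoint (IsPerm⇒Unique p) q (here refl)

-- The generating tree

encode : ℕ → List ℕ → List ℕ
encode zero π = []
encode (suc n) π = (n ∸ ldes π) ∷ encode n (remove (suc n) π)

-- Inserting n + 1 into a permutation of [n] at an inner slot q makes q + 1 the
-- last descent, so the recorded entry is n − 1 − q; the last slot keeps the last
-- descent and records one more than the previous entry, which inner slots
-- (q ≥ ldes) never do.
insertionSlot : ℕ → List ℕ → ℕ
insertionSlot x r with x ≟ suc (head₀ r)
... | yes _ = length r
... | no _ = length r ∸ suc x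

decode : List ℕ → List ℕ
decode [] = []
decode (x ∷ r) = insertAt (insertionSlot x r) (suc (length r)) (decode r)

insertionSlot-last : ∀ x r → x ≡ suc (head₀ r) → insertionSlot x r ≡ length r
insertionSlot-last x r e with x ≟ suc (head₀ r)
... | yes _ = refl
... | no ne = ⊥-elim (ne e)

insertionSlot-inner : ∀ x r → ¬ x ≡ suc (head₀ r) → insertionSlot x r ≡ length r ∸ suc x
insertionSlot-inner x r ne with x ≟ suc (head₀ r)
... | yes e = ⊥-elim (ne e)
... | no _ = refl

length-encode : ∀ n π → length (encode n π) ≡ n
length-encode zero π = refl
length-encode (suc n) π = cong suc (length-encode n _)

suc-∸-≤ : ∀ n l → suc n ∸ l ≤ suc (n ∸ l)
suc-∸-≤ n zero = ≤-refl
suc-∸-≤ zero (suc l) = ≤-trans (≤-reflexive (0∸n≡0 l)) z≤n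
suc-∸-≤ (suc n) (suc l) = suc-∸-≤ n l

length≡0⇒[] : ∀ {π : List ℕ} → length π ≡ 0 → π ≡ []
length≡0⇒[] {[]} _ = refl

encode-correct : ∀ n π → Av n π → RevCatalan (encode n π) × decode (encode n π) ≡ π × head₀ (encode n π) ≡ n ∸ 1 ∸ ldes π
encode-correct zero π (p , _) = tt , sym (length≡0⇒[] (IsPerm⇒length p)) , sym (0∸n≡0 (ldes π))
encode-correct (suc n) π s = encode-RevCatalan , decode-encode , refl
  where
  open MaxDeletion (deleteMax s)
  R : MaxInsertion n q σ
  R = insertMax σ-Av q≤n ldes≤q
  open MaxInsertion R
  IH : RevCatalan (encode n σ) × decode (encode n σ) ≡ σ × head₀ (encode n σ) ≡ n ∸ 1 ∸ ldes σ
  IH = encode-correct n σ σ-Av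
  encode-π : encode (suc n) π ≡ (n ∸ ldes π) ∷ encode n σ
  encode-π = cong (λ w → (n ∸ ldes π) ∷ encode n w) remove-π
  ldes-π : ldes π ≡ ldes (insertAt q (suc n) σ)
  ldes-π = cong ldes π≡insert
  length-σ : length σ ≡ n
  length-σ = IsPerm⇒length (proj₁ σ-Av)
  ldes-σ≤ldes-π : ldes σ ≤ ldes π
  ldes-σ≤ldes-π with m≤n⇒m<n∨m≡n q≤n
  ... | inj₁ lt = ≤-trans ldes≤q (≤-trans (n≤1+n q) (≤-reflexive (sym (trans ldes-π (ldes-inside lt)))))
  ... | inj₂ e = ≤-reflexive (sym (trans ldes-π (ldes-at-end e)))
  RevCatalan-∷ : ∀ m (w : List ℕ) → (m ≡ n) → RevCatalan (encode m w) → ldes w ≤ ldes π → RevCatalan ((m ∸ ldes π) ∷ encode m w)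
  RevCatalan-∷ zero w _ _ _ = 0∸n≡0 (ldes π)
  RevCatalan-∷ (suc m) w _ vr le = ≤-trans (∸-monoʳ-≤ (suc m) le) (suc-∸-≤ m (ldes w)) , vr
  encode-RevCatalan : RevCatalan (encode (suc n) π)
  encode-RevCatalan = subst RevCatalan (sym encode-π) (RevCatalan-∷ n σ refl (proj₁ IH) ldes-σ≤ldes-π)
  slot-at-end : ∀ m → m ≡ n → q ≡ m → insertionSlot (m ∸ ldes π) (encode m σ) ≡ q
  slot-at-end zero e e' = trans (insertionSlot-inner _ [] (λ e2 → 0≢1+n (trans (sym (0∸n≡0 (ldes π))) e2))) (sym e')
  slot-at-end (suc m') e e' = trans (insertionSlot-last _ (encode (suc m') σ)
          (trans (cong (suc m' ∸_) (trans ldes-π (ldes-at-end (trans e' e))))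
                 (suc-∸ (≤-trans (ldes≤length∸1 σ) (≤-reflexive (cong (_∸ 1) (trans length-σ (sym e))))))))
          (trans (length-encode (suc m') σ) (sym e'))
  slot-inside : ∀ m → m ≡ n → q < m → insertionSlot (m ∸ ldes π) (encode m σ) ≡ q
  slot-inside zero e lt = ⊥-elim (<⇒≱ lt z≤n)
  slot-inside (suc n') e lt = trans (insertionSlot-inner _ (encode (suc n') σ) ne)
          (trans (cong (_∸ suc (suc n' ∸ ldes π)) (length-encode (suc n') σ))
                 (trans (cong (λ w → n' ∸ (suc n' ∸ w)) (trans ldes-π (ldes-inside (subst (q <_) e lt)))) (m∸[m∸n]≡n (s≤s⁻¹ lt))))
    where
    xE : suc n' ∸ ldes π ≡ n' ∸ q
    xE = cong (suc n' ∸_) (trans ldes-π (ldes-inside (subst (q <_) e lt)))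
    ne : ¬ suc n' ∸ ldes π ≡ suc (n' ∸ ldes σ)
    ne e2 = 1+n≰n (≤-trans (≤-reflexive (trans (sym e2) xE)) (∸-monoʳ-≤ n' ldes≤q))
  slot : insertionSlot (n ∸ ldes π) (encode n σ) ≡ q
  slot with m≤n⇒m<n∨m≡n q≤n
  ... | inj₁ lt = slot-inside n refl lt
  ... | inj₂ e = slot-at-end n refl e
  decode-encode : decode (encode (suc n) π) ≡ π
  decode-encode = trans (cong decode encode-π)
    (trans (cong₂ (λ a b → insertAt a (suc b) (decode (encode n σ))) slot (length-encode n σ))
      (trans (cong (insertAt q (suc n)) (proj₁ (proj₂ IH))) (sym π≡insert)))

decode-step : ∀ n x r q → insertionSlot x r ≡ q → length r ≡ n → (σ-Av : Av n (decode r)) → encode n (decode r) ≡ r → (q≤ : q ≤ n) →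
         (ldq : ldes (decode r) ≤ q) → ((R : MaxInsertion n q (decode r)) → n ∸ ldes (insertAt q (suc n) (decode r)) ≡ x) →
         Av (suc n) (decode (x ∷ r)) × encode (suc n) (decode (x ∷ r)) ≡ x ∷ r
decode-step n x r q qe lr σ-Av ee q≤ ldq xe = decode-Av , encode-decode
  where
  σ = decode r
  R : MaxInsertion n q σ
  R = insertMax σ-Av q≤ ldq
  decode-∷ : decode (x ∷ r) ≡ insertAt q (suc n) σ
  decode-∷ = cong₂ (λ a b → insertAt a (suc b) σ) qe lr
  decode-Av : Av (suc n) (decode (x ∷ r))
  decode-Av = subst (Av (suc n)) (sym decode-∷) (MaxInsertion.insert-Av R)
  encode-decode : encode (suc n) (decode (x ∷ r)) ≡ x ∷ r
  encode-decode = trans (cong (encode (suc n)) decode-∷)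
    (cong₂ _∷_ (xe R) (trans (cong (encode n) (MaxInsertion.remove-insert R)) ee))

decode-correct : ∀ n r → length r ≡ n → RevCatalan r → Av n (decode r) × encode n (decode r) ≡ r
decode-correct zero [] _ _ = (↭-refl , Avoids321-[]) , refl
decode-correct (suc n) (x ∷ []) l refl with suc-injective l
... | refl = decode-step 0 0 [] 0 refl refl (↭-refl , Avoids321-[]) refl z≤n z≤n (λ R → refl)
decode-correct (suc n) (x ∷ h ∷ r') l (x≤ , vt) = decode-x∷r
  where
  r = h ∷ r'
  lr : length r ≡ n
  lr = suc-injective l
  IH : Av n (decode r) × encode n (decode r) ≡ r
  IH = decode-correct n r lr vt
  σ = decode r
  σ-Av : Av n σ
  σ-Av = proj₁ IH
  lσ : length σ ≡ n
  lσ = IsPerm⇒length (proj₁ σ-Av)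
  hE : h ≡ n ∸ 1 ∸ ldes σ
  hE = trans (cong head₀ (sym (proj₂ IH))) (proj₂ (proj₂ (encode-correct n σ σ-Av)))
  ldσ : ldes σ ≤ n ∸ 1
  ldσ = ≤-trans (ldes≤length∸1 σ) (≤-reflexive (cong (_∸ 1) lσ))
  n' : ℕ
  n' = n ∸ 1
  nE : n ≡ suc n'
  nE = trans (sym lr) (cong (λ w → suc (w ∸ 1)) lr)
  decode-x∷r : Av (suc n) (decode (x ∷ r)) × encode (suc n) (decode (x ∷ r)) ≡ x ∷ r
  decode-x∷r = go (x ≟ suc h)
   where
   go : Dec (x ≡ suc h) → Av (suc n) (decode (x ∷ r)) × encode (suc n) (decode (x ∷ r)) ≡ x ∷ r
   go (yes e) = decode-step n x r n (trans (insertionSlot-last x r e) lr) lr σ-Av (proj₂ IH) ≤-refl (≤-trans ldσ (m∸n≤m n 1))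
          (λ R → trans (cong (n ∸_) (MaxInsertion.ldes-at-end R refl)) (trans encoded-at-end (sym e)))
    where
    encoded-at-end : n ∸ ldes σ ≡ suc h
    encoded-at-end = trans (cong (_∸ ldes σ) nE) (trans (suc-∸ ldσ) (cong suc (sym hE)))
   go (no ne) = decode-step n x r q' (trans (insertionSlot-inner x r ne) (cong (_∸ suc x) lr)) lr σ-Av (proj₂ IH) q'≤ ldq encoded-inside
    where
    x≤h : x ≤ h
    x≤h with m≤n⇒m<n∨m≡n x≤
    ... | inj₁ lt = s≤s⁻¹ lt
    ... | inj₂ e = ⊥-elim (ne e)
    q' = n ∸ suc x
    q'≤ : q' ≤ n
    q'≤ = m∸n≤m n (suc x)
    x≤n' : x ≤ n' ∸ ldes σ
    x≤n' = ≤-trans x≤h (≤-reflexive hE)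
    ldq : ldes σ ≤ q'
    ldq = subst (λ w → ldes σ ≤ w ∸ suc x) (sym nE)
      (m+n≤o⇒m≤o∸n (ldes σ) (subst (_≤ n') (+-comm x (ldes σ)) (m≤o∸n⇒m+n≤o x ldσ x≤n')))
    q'<n : q' < n
    q'<n = subst (λ w → w ∸ suc x < w) (sym nE) (s≤s (m∸n≤m n' x))
    x≤n'' : x ≤ n'
    x≤n'' = ≤-trans x≤n' (m∸n≤m n' (ldes σ))
    encoded-inside : (R : MaxInsertion n q' σ) → n ∸ ldes (insertAt q' (suc n) σ) ≡ x
    encoded-inside R = trans (cong (n ∸_) (MaxInsertion.ldes-inside R q'<n))
      (subst (λ w → w ∸ suc (w ∸ suc x) ≡ x) (sym nE) (m∸[m∸n]≡n x≤n''))

generatingTree : ∀ n → Bijection (Av n) (RevCatalanOfLength n)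
generatingTree n = record
  { f = encode n ; g = decode
  ; f-resp = λ {π} s → length-encode n π , proj₁ (encode-correct n π s)
  ; g-resp = λ {r} (l , v) → proj₁ (decode-correct n r l v)
  ; g∘f = λ {π} s → proj₁ (proj₂ (encode-correct n π s))
  ; f∘g = λ {r} (l , v) → proj₂ (decode-correct n r l v) }

head-encode : ∀ n π → Av n π → head₀ (encode n π) ≡ n ∸ 1 ∸ ldes π
head-encode n π s = proj₂ (proj₂ (encode-correct n π s))

-- Inverses

pos-∈ : ∀ {x} {π : List ℕ} → x ∈ π → Σ ℕ λ i → pos x π ≡ suc i × i < length π × at π i ≡ x
pos-∈ {x} {y ∷ ys} p with x ≡ᵇ y in e
... | true = 0 , refl , s≤s z≤n , sym (≡ᵇ⇒≡ x y (subst T (sym e) tt))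
... | false with p
...   | here refl = ⊥-elim (subst T e (≡⇒≡ᵇ x x refl))
...   | there p' with pos-∈ p'
...     | i , e' , lt , a rewrite e' = suc i , refl , s≤s lt , a

pos-at : ∀ {π : List ℕ} i → Unique π → i < length π → pos (at π i) π ≡ suc i
pos-at {π} i u lt with pos-∈ (at∈ π i lt)
... | j , e , lj , a = trans e (cong suc (at-injective j i u lj lt a))

at-applyUpTo : ∀ (f : ℕ → ℕ) n i → i < n → at (applyUpTo f n) i ≡ f i
at-applyUpTo f (suc n) zero _ = refl
at-applyUpTo f (suc n) (suc i) (s≤s lt) = at-applyUpTo (λ k → f (suc k)) n i lt

at-range : ∀ n i → i < n → at (range n) i ≡ suc i
at-range n i lt = trans (at-map suc (upTo n) i (subst (i <_) (sym (length-upTo n)) lt)) (cong suc (at-applyUpTo (λ k → k) n i lt))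

length-inv : ∀ π → length (inv π) ≡ length π
length-inv π = length-range' (length π)
  where
  length-range' : ∀ n → length (map (λ v → pos v π) (range n)) ≡ n
  length-range' n = trans (length-map _ (range n)) (length-range n)

at-inv : ∀ π i → i < length π → at (inv π) i ≡ pos (suc i) π
at-inv π i lt = trans (at-map (λ v → pos v π) (range (length π)) i (subst (i <_) (sym (length-range (length π))) lt))
                      (cong (λ v → pos v π) (at-range (length π) i lt))

map-pos : ∀ (π : List ℕ) → Unique π → map (λ v → pos v π) π ≡ range (length π)
map-pos π u = at-ext _ _ (trans (length-map _ π) (sym (length-range (length π))))
  (λ i lt → let lt' = subst (i <_) (length-map _ π) lt in
     trans (at-map (λ v → pos v π) π i lt') (trans (pos-at i u lt') (sym (at-range (length π) i lt'))))

IsPerm-inv : ∀ {n π} → IsPerm n π → IsPerm n (inv π)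
IsPerm-inv {n} {π} p = subst (λ w → map (λ v → pos v π) (range w) ↭ range n) (sym (IsPerm⇒length p))
  (↭-trans (↭-map⁺ (λ v → pos v π) (↭-sym p))
           (↭-reflexive (trans (map-pos π (IsPerm⇒Unique p)) (cong range (IsPerm⇒length p)))))

inv-inv : ∀ {n π} → IsPerm n π → inv (inv π) ≡ π
inv-inv {n} {π} p = at-ext _ _ (trans (length-inv (inv π)) (length-inv π)) h
  where
  ip = IsPerm-inv p
  h : ∀ i → i < length (inv (inv π)) → at (inv (inv π)) i ≡ at π i
  h i lt = trans (at-inv (inv π) i lt') (lem (at π i) refl)
    where
    lt' : i < length (inv π)
    lt' = subst (i <_) (length-inv (inv π)) lt
    ltπ : i < length π
    ltπ = subst (i <_) (length-inv π) lt'
    lem : ∀ v → at π i ≡ v → pos (suc i) (inv π) ≡ v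
    lem zero e = ⊥-elim (<-irrefl refl (proj₁ (∈-IsPerm⁻ p (subst (_∈ π) e (at∈ π i ltπ)))))
    lem (suc v') e = trans (cong (λ w → pos w (inv π)) (sym atv)) (pos-at v' (IsPerm⇒Unique ip) v'lt)
      where
      v'lt : v' < length (inv π)
      v'lt = subst (v' <_) (sym (trans (length-inv π) (IsPerm⇒length p))) (proj₂ (∈-IsPerm⁻ p (subst (_∈ π) e (at∈ π i ltπ))))
      atv : at (inv π) v' ≡ suc i
      atv = trans (at-inv π v' (subst (v' <_) (length-inv π) v'lt)) (trans (cong (λ w → pos w π) (sym e)) (pos-at i (IsPerm⇒Unique p) ltπ))

Avoids321-inv : ∀ {n π} → IsPerm n π → Avoids321 π → Avoids321 (inv π)
Avoids321-inv {n} {π} p av = ¬Has321⇒Avoids321 {inv π} np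
  where
  mem : ∀ t → t < length π → suc t ∈ π
  mem t lt = ∈-IsPerm⁺ p (s≤s z≤n) (≤-trans lt (≤-reflexive (IsPerm⇒length p)))
  np : ¬ Has321 (inv π)
  np (i , j , l , ij , jl , ll , vj , vl) = go (pos-∈ (mem i iπ)) (pos-∈ (mem j jπ)) (pos-∈ (mem l lπ))
    where
    lπ : l < length π
    lπ = subst (l <_) (length-inv π) ll
    jπ : j < length π
    jπ = <-trans jl lπ
    iπ : i < length π
    iπ = <-trans ij jπ
    go : (Σ ℕ λ a → pos (suc i) π ≡ suc a × a < length π × at π a ≡ suc i) →
         (Σ ℕ λ a → pos (suc j) π ≡ suc a × a < length π × at π a ≡ suc j) →
         (Σ ℕ λ a → pos (suc l) π ≡ suc a × a < length π × at π a ≡ suc l) → ⊥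
    go (ai , ei , lti , ati) (aj , ej , ltj , atj) (al , el , ltl , atl) =
      Avoids321⇒¬Has321 {π} av (al , aj , ai ,
         s<s⁻¹ (subst₂ _<_ (trans (at-inv π l lπ) el) (trans (at-inv π j jπ) ej) vl) ,
         s<s⁻¹ (subst₂ _<_ (trans (at-inv π j jπ) ej) (trans (at-inv π i iπ) ei) vj) ,
         lti ,
         subst₂ _<_ (sym atj) (sym atl) (s≤s jl) ,
         subst₂ _<_ (sym ati) (sym atj) (s≤s ij))

inv-bijection : ∀ n v → Bijection (λ π → Av n π × ldes (inv π) ≡ v) (λ σ → Av n σ × ldes σ ≡ v)
inv-bijection n v = record
  { f = inv ; g = inv
  ; f-resp = λ { ((p , av) , e) → (IsPerm-inv p , Avoids321-inv p av) , e }
  ; g-resp = λ { ((p , av) , e) → (IsPerm-inv p , Avoids321-inv p av) , trans (cong ldes (inv-inv p)) e }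
  ; g∘f = λ { ((p , _) , _) → inv-inv p }
  ; f∘g = λ { ((p , _) , _) → inv-inv p } }

-- Direct sums and blocks

module _ {P Q : ℕ → Set} (P? : Decidable P) (Q? : Decidable Q) where
  count-ext : ∀ xs → (∀ i → i ∈ xs → P i → Q i) → (∀ i → i ∈ xs → Q i → P i) →
              length (filter P? xs) ≡ length (filter Q? xs)
  count-ext [] _ _ = refl
  count-ext (x ∷ xs) pq qp with P? x | Q? x
  ... | yes p | yes q = cong suc (count-ext xs (λ i m → pq i (there m)) (λ i m → qp i (there m)))
  ... | no np | no nq = count-ext xs (λ i m → pq i (there m)) (λ i m → qp i (there m))
  ... | yes p | no nq = ⊥-elim (nq (pq x (here refl) p))
  ... | no np | yes q = ⊥-elim (np (qp x (here refl) q))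

module _ {P : ℕ → Set} (P? : Decidable P) where
  count-++ : ∀ xs ys → length (filter P? (xs ++ ys)) ≡ length (filter P? xs) + length (filter P? ys)
  count-++ xs ys = trans (cong length (filter-++ P? xs ys)) (length-++ (filter P? xs))

  count-map : ∀ (f : ℕ → ℕ) xs → length (filter P? (map f xs)) ≡ length (filter (λ x → P? (f x)) xs)
  count-map f [] = refl
  count-map f (x ∷ xs) with P? (f x)
  ... | yes _ = cong suc (count-map f xs)
  ... | no _ = count-map f xs

  count-none : ∀ xs → (∀ i → i ∈ xs → ¬ P i) → length (filter P? xs) ≡ 0
  count-none [] _ = refl
  count-none (x ∷ xs) h with P? x
  ... | yes p = ⊥-elim (h x (here refl) p)
  ... | no _ = count-none xs (λ i m → h i (there m))

  count-one : ∀ x → P x → length (filter P? (x ∷ [])) ≡ 1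
  count-one x p with P? x
  ... | yes _ = refl
  ... | no np = ⊥-elim (np p)

  count-two : ∀ xs i j → Unique xs → i ∈ xs → j ∈ xs → ¬ i ≡ j → P i → P j → 2 ≤ length (filter P? xs)
  count-two xs i j u mi mj ne pi pj =
    Unique-⊆⇒length≤ {xs = i ∷ j ∷ []} (((λ e → ne e) ∷ []) ∷ ([] ∷ [])) (λ { (here refl) → ∈-filter⁺ P? mi pi ; (there (here refl)) → ∈-filter⁺ P? mj pj })

range-+ : ∀ a b → range (a + b) ≡ range a ++ map (a +_) (range b)
range-+ a zero = trans (cong range (+-identityʳ a)) (sym (++-identityʳ (range a)))
range-+ a (suc b) = begin
  range (a + suc b)                              ≡⟨ cong range (+-suc a b) ⟩
  range (suc (a + b))                            ≡⟨ range-suc (a + b) ⟩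
  range (a + b) ++ [ suc (a + b) ]               ≡⟨ cong (_++ [ suc (a + b) ]) (range-+ a b) ⟩
  (range a ++ map (a +_) (range b)) ++ [ suc (a + b) ]
      ≡⟨ ++-assoc (range a) (map (a +_) (range b)) [ suc (a + b) ] ⟩
  range a ++ (map (a +_) (range b) ++ [ suc (a + b) ])
      ≡⟨ cong (λ w → range a ++ (map (a +_) (range b) ++ [ w ])) (sym (+-suc a b)) ⟩
  range a ++ (map (a +_) (range b) ++ map (a +_) [ suc b ]) ≡⟨ cong (range a ++_) (sym (map-++ (a +_) (range b) [ suc b ])) ⟩
  range a ++ map (a +_) (range b ++ [ suc b ])     ≡⟨ cong (λ w → range a ++ map (a +_) w) (sym (range-suc b)) ⟩
  range a ++ map (a +_) (range (suc b)) ∎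
  where open ≡-Reasoning

Cut : List ℕ → ℕ → Set
Cut π i = All (_≤ i) (take i π)

cut? : (π : List ℕ) → Decidable (Cut π)
cut? π i = all? (λ v → v ≤? i) (take i π)

take-++ˡ : ∀ (xs ys : List ℕ) i → i ≤ length xs → take i (xs ++ ys) ≡ take i xs
take-++ˡ xs ys zero _ = refl
take-++ˡ (x ∷ xs) ys (suc i) (s≤s le) = cong (x ∷_) (take-++ˡ xs ys i le)

take-++ʳ : ∀ (xs ys : List ℕ) j → take (length xs + j) (xs ++ ys) ≡ xs ++ take j ys
take-++ʳ [] ys j = refl
take-++ʳ (x ∷ xs) ys j = cong (x ∷_) (take-++ʳ xs ys j)

∈-take : ∀ {x} (xs : List ℕ) i → x ∈ take i xs → x ∈ xs
∈-take (y ∷ xs) (suc i) (here e) = here e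
∈-take (y ∷ xs) (suc i) (there p) = there (∈-take xs i p)

∈-drop : ∀ {x} (xs : List ℕ) i → x ∈ drop i xs → x ∈ xs
∈-drop xs zero p = p
∈-drop (y ∷ xs) (suc i) p = there (∈-drop xs i p)

¬Has321-++ : ∀ (β τ : List ℕ) → ¬ Has321 β → ¬ Has321 τ → (∀ {x y} → x ∈ β → y ∈ τ → x < y) → ¬ Has321 (β ++ τ)
¬Has321-++ β τ nb nt lt (i , j , l , ij , jl , ll , vj , vl) with l <? length β
... | yes lβ = nb (i , j , l , ij , jl , lβ ,
        subst₂ _<_ (at-++ˡ β τ j jβ) (at-++ˡ β τ i iβ) vj ,
        subst₂ _<_ (at-++ˡ β τ l lβ) (at-++ˡ β τ j jβ) vl)
  where
  jβ = <-trans jl lβ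
  iβ = <-trans ij jβ
... | no nl with i <? length β
...   | yes iβ = <-asym (<-trans vl vj)
          (subst₂ _<_ (sym (at-++ˡ β τ i iβ)) (sym lτe)
             (lt (at∈ β i iβ) (at∈ τ (l ∸ length β) lτ)))
  where
  lb≤l : length β ≤ l
  lb≤l = ≮⇒≥ nl
  lτ : l ∸ length β < length τ
  lτ = +-cancelˡ-< (length β) (l ∸ length β) (length τ)
         (subst₂ _<_ (sym (m+[n∸m]≡n lb≤l)) (length-++ β) ll)
  lτe : at (β ++ τ) l ≡ at τ (l ∸ length β)
  lτe = trans (cong (at (β ++ τ)) (sym (m+[n∸m]≡n lb≤l))) (at-++ʳ β τ (l ∸ length β))
...   | no ni = nt (i ∸ b , j ∸ b , l ∸ b , ∸-monoˡ-< ij bi , ∸-monoˡ-< jl bj ,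
          +-cancelˡ-< b (l ∸ b) (length τ) (subst₂ _<_ (sym (m+[n∸m]≡n bl')) (length-++ β) ll) ,
          subst₂ _<_ (e j bj) (e i bi) vj , subst₂ _<_ (e l bl') (e j bj) vl)
  where
  b = length β
  bi : b ≤ i
  bi = ≮⇒≥ ni
  bj : b ≤ j
  bj = ≤-trans bi (<⇒≤ ij)
  bl' : b ≤ l
  bl' = ≤-trans bj (<⇒≤ jl)
  e : ∀ t → b ≤ t → at (β ++ τ) t ≡ at τ (t ∸ b)
  e t bt = trans (cong (at (β ++ τ)) (sym (m+[n∸m]≡n bt))) (at-++ʳ β τ (t ∸ b))

¬Has321-take : ∀ (π : List ℕ) c → ¬ Has321 π → ¬ Has321 (take c π)
¬Has321-take π c np (i , j , l , ij , jl , ll , vj , vl) =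
  np (i , j , l , ij , jl , ≤-trans ll (lt c π) ,
      subst₂ _<_ (at-take π c j (<-trans jl lc)) (at-take π c i (<-trans ij (<-trans jl lc))) vj ,
      subst₂ _<_ (at-take π c l lc) (at-take π c j (<-trans jl lc)) vl)
  where
  lt : ∀ c (xs : List ℕ) → length (take c xs) ≤ length xs
  lt zero xs = z≤n
  lt (suc c) [] = z≤n
  lt (suc c) (x ∷ xs) = s≤s (lt c xs)
  lc' : ∀ c (xs : List ℕ) → length (take c xs) ≤ c
  lc' zero xs = z≤n
  lc' (suc c) [] = z≤n
  lc' (suc c) (x ∷ xs) = s≤s (lc' c xs)
  lc : l < c
  lc = <-≤-trans ll (lc' c π)

¬Has321-drop : ∀ (π : List ℕ) c → ¬ Has321 π → ¬ Has321 (drop c π)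
¬Has321-drop π c np (i , j , l , ij , jl , ll , vj , vl) =
  np (c + i , c + j , c + l , +-monoʳ-< c ij , +-monoʳ-< c jl ,
      subst (c + l <_) (m+[n∸m]≡n' ) (+-monoʳ-< c (subst (l <_) (length-drop c π) ll)) ,
      subst₂ _<_ (at-drop π c j) (at-drop π c i) vj , subst₂ _<_ (at-drop π c l) (at-drop π c j) vl)
  where
  m+[n∸m]≡n' : c + (length π ∸ c) ≡ length π
  m+[n∸m]≡n' with c ≤? length π
  ... | yes le = m+[n∸m]≡n le
  ... | no nle = ⊥-elim (n≮0 (≤-trans ll (≤-reflexive (trans (length-drop c π) (m≤n⇒m∸n≡0 (<⇒≤ (≰⇒> nle)))))))

¬Has321-map : ∀ (f : ℕ → ℕ) (ys : List ℕ) → (∀ x y → f x < f y → x < y) → ¬ Has321 ys → ¬ Has321 (map f ys)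
¬Has321-map f ys refl' np (i , j , l , ij , jl , ll , vj , vl) =
  np (i , j , l , ij , jl , lys ,
      refl' _ _ (subst₂ _<_ (at-map f ys j jys) (at-map f ys i iys) vj) ,
      refl' _ _ (subst₂ _<_ (at-map f ys l lys) (at-map f ys j jys) vl))
  where
  lys : l < length ys
  lys = subst (l <_) (length-map f ys) ll
  jys = <-trans jl lys
  iys = <-trans ij jys

directSum : List ℕ → List ℕ → List ℕ
directSum β σ = β ++ map (length β +_) σ

cut-left⇒ : ∀ (β τ : List ℕ) i → i ≤ length β → Cut (β ++ τ) i → Cut β i
cut-left⇒ β τ i le c = subst (All (_≤ i)) (take-++ˡ β τ i le) c
cut-left⇐ : ∀ (β τ : List ℕ) i → i ≤ length β → Cut β i → Cut (β ++ τ) i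
cut-left⇐ β τ i le c = subst (All (_≤ i)) (sym (take-++ˡ β τ i le)) c

take-directSum : ∀ (β σ : List ℕ) j → take (length β + j) (directSum β σ) ≡ β ++ map (length β +_) (take j σ)
take-directSum β σ j = trans (take-++ʳ β (map (length β +_) σ) j) (cong (β ++_) (take-map j σ))

cut-right⇒ : ∀ (β σ : List ℕ) j → Cut (directSum β σ) (length β + j) → Cut σ j
cut-right⇒ β σ j c = All.map (λ {x} le → +-cancelˡ-≤ (length β) x j le)
  (AllP.map⁻ (AllP.++⁻ʳ β (subst (All (_≤ length β + j)) (take-directSum β σ j) c)))
cut-right⇐ : ∀ (β σ : List ℕ) j → All (_≤ length β) β → Cut σ j → Cut (directSum β σ) (length β + j)
cut-right⇐ β σ j aβ c = subst (All (_≤ length β + j)) (sym (take-directSum β σ j))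
  (AllP.++⁺ (All.map (λ le → ≤-trans le (m≤m+n (length β) j)) aβ)
            (AllP.map⁺ (All.map (λ le → +-monoʳ-≤ (length β) le) c)))

length-directSum : ∀ (β σ : List ℕ) → length (directSum β σ) ≡ length β + length σ
length-directSum β σ = trans (length-++ β) (cong (length β +_) (length-map _ σ))

bl-directSum : ∀ (β σ : List ℕ) → All (_≤ length β) β → bl (directSum β σ) ≡ bl β + bl σ
bl-directSum β σ aβ = begin
  bl π ≡⟨ cong (λ w → length (filter (cut? π) (range w))) (length-directSum β σ) ⟩
  length (filter (cut? π) (range (a + b))) ≡⟨ cong (λ w → length (filter (cut? π) w)) (range-+ a b) ⟩
  length (filter (cut? π) (range a ++ map (a +_) (range b))) ≡⟨ count-++ (cut? π) (range a) _ ⟩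
  length (filter (cut? π) (range a)) + length (filter (cut? π) (map (a +_) (range b)))
     ≡⟨ cong₂ _+_ (count-ext (cut? π) (cut? β) (range a)
                     (λ i m c → cut-left⇒ β _ i (proj₂ (∈-range⁻ m)) c)
                     (λ i m c → cut-left⇐ β _ i (proj₂ (∈-range⁻ m)) c))
                  (trans (count-map (cut? π) (a +_) (range b))
                     (count-ext (λ j → cut? π (a + j)) (cut? σ) (range b)
                        (λ j _ c → cut-right⇒ β σ j c) (λ j _ c → cut-right⇐ β σ j aβ c))) ⟩
  bl β + bl σ ∎
  where
  open ≡-Reasoning
  π = directSum β σ
  a = length β
  b = length σ

firstCut : List ℕ → ℕ → ℕ → ℕ
firstCut π i zero = i
firstCut π i (suc k) with cut? π i
... | yes _ = i
... | no _ = firstCut π (suc i) k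

record IsFirstCut (π : List ℕ) (i k c : ℕ) : Set where
  field
    lo : i ≤ c
    hi : c ≤ i + k
    isCut : Cut π c
    first : ∀ j → i ≤ j → j < c → ¬ Cut π j

firstCut-spec : ∀ π k i → Cut π (i + k) → IsFirstCut π i k (firstCut π i k)
firstCut-spec π zero i ct = record { lo = ≤-refl ; hi = ≤-reflexive (sym (+-identityʳ i)) ; isCut = subst (Cut π) (+-identityʳ i) ct
                             ; first = λ j a b → ⊥-elim (<-irrefl refl (<-≤-trans b a)) }
firstCut-spec π (suc k) i ct with cut? π i
... | yes p = record { lo = ≤-refl ; hi = m≤m+n i (suc k) ; isCut = p ; first = λ j a b → ⊥-elim (<-irrefl refl (<-≤-trans b a)) }
... | no np = record { lo = ≤-trans (n≤1+n i) (IsFirstCut.lo IH) ; hi = ≤-trans (IsFirstCut.hi IH) (≤-reflexive (sym (+-suc i k)))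
                     ; isCut = IsFirstCut.isCut IH ; first = fst }
  where
  IH : IsFirstCut π (suc i) k (firstCut π (suc i) k)
  IH = firstCut-spec π k (suc i) (subst (Cut π) (+-suc i k) ct)
  fst : ∀ j → i ≤ j → j < firstCut π (suc i) k → ¬ Cut π j
  fst j a b with m≤n⇒m<n∨m≡n a
  ... | inj₁ lt = IsFirstCut.first IH j lt b
  ... | inj₂ refl = np

firstBlockSize : List ℕ → ℕ
firstBlockSize π = firstCut π 1 (length π ∸ 1)

Cut-size : ∀ {n π} → IsPerm n π → Cut π n
Cut-size {n} {π} p = subst (λ w → All (_≤ n) (take w π)) (IsPerm⇒length p)
  (subst (All (_≤ n)) (sym (take-all (length π) π ≤-refl)) (All.tabulate (λ q → proj₂ (∈-IsPerm⁻ p q))))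

firstBlockSize-spec : ∀ {n π} → IsPerm (suc n) π → IsFirstCut π 1 n (firstBlockSize π)
firstBlockSize-spec {n} {π} p = subst (λ w → IsFirstCut π 1 n (firstCut π 1 w)) (sym (cong (_∸ 1) (IsPerm⇒length p)))
  (firstCut-spec π n 1 (Cut-size p))

IsPerm-take : ∀ {n π c} → IsPerm n π → c ≤ n → Cut π c → IsPerm c (take c π)
IsPerm-take {n} {π} {c} p le ct =
  Unique⇒IsPerm (UP.take⁺ c (IsPerm⇒Unique p)) (λ q → proj₁ (∈-IsPerm⁻ p (∈-take π c q)) , All.lookup ct q)
         (length-take≤ π c (≤-trans le (≤-reflexive (sym (IsPerm⇒length p)))))

Cut⇒drop> : ∀ {n π c} → IsPerm n π → c ≤ n → Cut π c → ∀ {x} → x ∈ drop c π → c < x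
Cut⇒drop> {n} {π} {c} p le ct {x} q with x ≤? c
... | no nle = ≰⇒> nle
... | yes xle = ⊥-elim (Unique-++-disjoint (subst Unique (sym (take++drop≡id c π)) (IsPerm⇒Unique p)) inT q)
  where
  inT : x ∈ take c π
  inT = ∈-IsPerm⁺ (IsPerm-take p le ct) (proj₁ (∈-IsPerm⁻ p (∈-drop π c q))) xle

IsPerm-drop : ∀ {n π c} → IsPerm n π → c ≤ n → Cut π c → IsPerm (n ∸ c) (map (_∸ c) (drop c π))
IsPerm-drop {n} {π} {c} p le ct =
  Unique⇒IsPerm (Unique-map-injectiveOn (_∸ c) (λ {x} {y} → inj x y) (UP.drop⁺ c (IsPerm⇒Unique p))) mem
         (trans (length-map _ (drop c π)) (trans (length-drop c π) (cong (_∸ c) (IsPerm⇒length p))))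
  where
  inj : ∀ x y → x ∈ drop c π → y ∈ drop c π → x ∸ c ≡ y ∸ c → x ≡ y
  inj x y mx my e = trans (sym (m+[n∸m]≡n (<⇒≤ (Cut⇒drop> p le ct mx))))
                      (trans (cong (c +_) e) (m+[n∸m]≡n (<⇒≤ (Cut⇒drop> p le ct my))))
  mem : ∀ {z} → z ∈ map (_∸ c) (drop c π) → 1 ≤ z × z ≤ n ∸ c
  mem q with ∈-map⁻ (_∸ c) q
  ... | x , mx , refl = m<n⇒0<n∸m (Cut⇒drop> p le ct mx) , ∸-monoˡ-≤ c (proj₂ (∈-IsPerm⁻ p (∈-drop π c mx)))

directSum-split : ∀ {n π c} → IsPerm n π → c ≤ n → Cut π c → directSum (take c π) (map (_∸ c) (drop c π)) ≡ π
directSum-split {n} {π} {c} p le ct = trans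
  (cong (take c π ++_)
     (trans (cong (λ w → map (w +_) (map (_∸ c) (drop c π))) (length-take≤ π c (≤-trans le (≤-reflexive (sym (IsPerm⇒length p))))))
            (trans (sym (map-∘ (drop c π))) (map-id-local (All.tabulate (λ x∈ → m+[n∸m]≡n (<⇒≤ (Cut⇒drop> p le ct x∈))))))))
  (take++drop≡id c π)

IsPerm-directSum : ∀ {n c β σ} → c ≤ n → IsPerm c β → IsPerm (n ∸ c) σ → IsPerm n (directSum β σ)
IsPerm-directSum {n} {c} {β} {σ} le pβ pσ =
  subst (λ w → β ++ map (w +_) σ ↭ range n) (sym (IsPerm⇒length pβ))
    (↭-trans (↭-++⁺ pβ (↭-map⁺ (c +_) pσ))
      (↭-reflexive (trans (sym (range-+ c (n ∸ c))) (cong range (m+[n∸m]≡n le)))))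

Indecomposable : ℕ → List ℕ → Set
Indecomposable c β = Av c β × bl β ≡ 1

FirstBlockSplit : ℕ → List ℕ × List ℕ → Set
FirstBlockSplit n = Convolution n Indecomposable (λ c → Av (n ∸ c))

splitFirstBlock : List ℕ → List ℕ × List ℕ
splitFirstBlock π = take (firstBlockSize π) π , map (_∸ firstBlockSize π) (drop (firstBlockSize π) π)

IsPerm⇒All≤ : ∀ {c β} → IsPerm c β → All (_≤ length β) β
IsPerm⇒All≤ {c} {β} p = All.tabulate (λ q → subst (_ ≤_) (sym (IsPerm⇒length p)) (proj₂ (∈-IsPerm⁻ p q)))

bl≡1 : ∀ {c β} → IsPerm c β → 1 ≤ c → (∀ j → 1 ≤ j → j < c → ¬ Cut β j) → bl β ≡ 1
bl≡1 {suc c'} {β} p _ first = begin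
  length (filter (cut? β) (range (length β))) ≡⟨ cong (λ w → length (filter (cut? β) (range w))) (IsPerm⇒length p) ⟩
  length (filter (cut? β) (range (suc c'))) ≡⟨ cong (λ w → length (filter (cut? β) w)) (range-suc c') ⟩
  length (filter (cut? β) (range c' ++ [ suc c' ])) ≡⟨ count-++ (cut? β) (range c') [ suc c' ] ⟩
  length (filter (cut? β) (range c')) + length (filter (cut? β) [ suc c' ])
     ≡⟨ cong₂ _+_ (count-none (cut? β) (range c') (λ i m → first i (proj₁ (∈-range⁻ m)) (s≤s (proj₂ (∈-range⁻ m)))))
                  (count-one (cut? β) (suc c') (Cut-size p)) ⟩
  1 ∎
  where open ≡-Reasoning

firstBlockSize-directSum : ∀ {n c β σ} → IsPerm c β → bl β ≡ 1 → 1 ≤ c → IsPerm (suc n) (directSum β σ) → firstBlockSize (directSum β σ) ≡ c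
firstBlockSize-directSum {n} {c} {β} {σ} pβ b1 c1 pπ = ≤-antisym (≮⇒≥ h1) (≮⇒≥ h2)
  where
  F : IsFirstCut (directSum β σ) 1 n (firstBlockSize (directSum β σ))
  F = firstBlockSize-spec pπ
  lβ : length β ≡ c
  lβ = IsPerm⇒length pβ
  cutβc : Cut β c
  cutβc = Cut-size pβ
  h2 : ¬ firstBlockSize (directSum β σ) < c
  h2 lt = 1+n≰n (≤-trans
            (count-two (cut? β) (range (length β)) (firstBlockSize (directSum β σ)) (length β) (Unique-range _)
              (∈-range⁺ (IsFirstCut.lo F) (≤-trans (<⇒≤ lt) (≤-reflexive (sym lβ))))
              (∈-range⁺ (subst (1 ≤_) (sym lβ) c1) ≤-refl)
              (λ e → <-irrefl (trans e lβ) lt)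
              (cut-left⇒ β _ _ (≤-trans (<⇒≤ lt) (≤-reflexive (sym lβ))) (IsFirstCut.isCut F))
              (subst (Cut β) (sym lβ) cutβc)) (≤-reflexive b1))
  h1 : ¬ c < firstBlockSize (directSum β σ)
  h1 lt = IsFirstCut.first F c c1 lt (cut-left⇐ β _ c (≤-reflexive (sym lβ)) cutβc)

firstBlock-bijection : ∀ n → Bijection (Av (suc n)) (FirstBlockSplit (suc n))
firstBlock-bijection n = record { f = splitFirstBlock ; g = λ z → directSum (proj₁ z) (proj₂ z) ; f-resp = f-resp ; g-resp = g-resp ; g∘f = g∘f ; f∘g = f∘g }
  where
  f-resp : ∀ {π} → Av (suc n) π → FirstBlockSplit (suc n) (splitFirstBlock π)
  f-resp {π} (p , av) = c , ∈-range⁺ (IsFirstCut.lo F) (IsFirstCut.hi F) ,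
    ((IsPerm-take p (IsFirstCut.hi F) (IsFirstCut.isCut F) , ¬Has321⇒Avoids321 {take c π} (¬Has321-take π c (Avoids321⇒¬Has321 {π} av))) ,
     bl≡1 (IsPerm-take p (IsFirstCut.hi F) (IsFirstCut.isCut F)) (IsFirstCut.lo F)
       (λ j j1 jc ct → IsFirstCut.first F j j1 jc (subst (All (_≤ j)) (trans (take-take j c π) (cong (λ w → take w π) (m≤n⇒m⊓n≡m (<⇒≤ jc)))) ct))) ,
    (IsPerm-drop p (IsFirstCut.hi F) (IsFirstCut.isCut F) ,
     ¬Has321⇒Avoids321 {map (_∸ c) (drop c π)} (¬Has321-map (_∸ c) (drop c π) (λ x y lt → ∸-reflects-< lt) (¬Has321-drop π c (Avoids321⇒¬Has321 {π} av))))
    where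
    F : IsFirstCut π 1 n (firstBlockSize π)
    F = firstBlockSize-spec p
    c = firstBlockSize π
    ∸-reflects-< : ∀ {x y} → x ∸ c < y ∸ c → x < y
    ∸-reflects-< {x} {y} lt with x <? y
    ... | yes a = a
    ... | no na = ⊥-elim (<⇒≱ lt (∸-monoˡ-≤ c (≮⇒≥ na)))
  g-resp : ∀ {z} → FirstBlockSplit (suc n) z → Av (suc n) (directSum (proj₁ z) (proj₂ z))
  g-resp {β , σ} (c , cm , ((pβ , avβ) , b1) , (pσ , avσ)) =
    IsPerm-directSum (proj₂ (∈-range⁻ cm)) pβ pσ ,
    ¬Has321⇒Avoids321 {directSum β σ} (¬Has321-++ β (map (length β +_) σ) (Avoids321⇒¬Has321 {β} avβ)
      (¬Has321-map (length β +_) σ (λ x y lt → +-cancelˡ-< (length β) x y lt) (Avoids321⇒¬Has321 {σ} avσ))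
      (λ {x} {y} mx my → lt x y mx my))
    where
    lt : ∀ x y → x ∈ β → y ∈ map (length β +_) σ → x < y
    lt x y mx my with ∈-map⁻ (length β +_) my
    ... | y' , my' , refl = <-≤-trans (s≤s (All.lookup (IsPerm⇒All≤ pβ) mx))
                              (≤-trans (≤-reflexive (sym (+-comm (length β) 1))) (+-monoʳ-≤ (length β) (proj₁ (∈-IsPerm⁻ pσ my'))))
  g∘f : ∀ {π} → Av (suc n) π → directSum (proj₁ (splitFirstBlock π)) (proj₂ (splitFirstBlock π)) ≡ π
  g∘f {π} (p , _) = directSum-split p (IsFirstCut.hi F) (IsFirstCut.isCut F)
    where
    F : IsFirstCut π 1 n (firstBlockSize π)
    F = firstBlockSize-spec p
  f∘g : ∀ {z} → FirstBlockSplit (suc n) z → splitFirstBlock (directSum (proj₁ z) (proj₂ z)) ≡ z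
  f∘g {β , σ} q@(c , cm , ((pβ , avβ) , b1) , (pσ , avσ)) =
    cong₂ _,_ (trans (cong (λ w → take w (directSum β σ)) fc) (trans (cong (λ w → take w (directSum β σ)) (sym lβ)) (take-++ β _)))
      (trans (cong (λ w → map (_∸ w) (drop w (directSum β σ))) fc)
        (trans (cong (λ w → map (_∸ c) (drop w (directSum β σ))) (sym lβ))
          (trans (cong (map (_∸ c)) (drop-++ β _))
            (trans (sym (map-∘ σ)) (map-id-local (All.tabulate (λ {x} _ → trans (cong (λ w → w + x ∸ c) lβ) (m+n∸m≡n c x))))))))
    where
    lβ : length β ≡ c
    lβ = IsPerm⇒length pβ
    fc : firstBlockSize (directSum β σ) ≡ c
    fc = firstBlockSize-directSum pβ b1 (proj₁ (∈-range⁻ cm)) (proj₁ (g-resp q))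

bl-splitFirstBlock : ∀ n π → Av (suc n) π → bl π ≡ suc (bl (proj₂ (splitFirstBlock π)))
bl-splitFirstBlock n π s with Bijection.f-resp (firstBlock-bijection n) s
... | c , cm , ((pβ , _) , b1) , _ =
  trans (cong bl (sym (Bijection.g∘f (firstBlock-bijection n) s)))
    (trans (bl-directSum (proj₁ (splitFirstBlock π)) (proj₂ (splitFirstBlock π)) (IsPerm⇒All≤ pβ)) (cong (_+ bl (proj₂ (splitFirstBlock π))) b1))

-- Splitting Catalan sequences

CatalanOfLength : ℕ → List ℕ → Set
CatalanOfLength n d = length d ≡ n × Catalan d

PrimeCatalan : ℕ → List ℕ → Set
PrimeCatalan c d = CatalanOfLength c d × zeros d ≡ 1

FirstRunSplit : ℕ → List ℕ × List ℕ → Set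
FirstRunSplit n = Convolution n PrimeCatalan (λ c → CatalanOfLength (n ∸ c))

breakAtZero : List ℕ → List ℕ × List ℕ
breakAtZero [] = [] , []
breakAtZero (zero ∷ xs) = [] , zero ∷ xs
breakAtZero (suc x ∷ xs) = suc x ∷ proj₁ (breakAtZero xs) , proj₂ (breakAtZero xs)

splitFirstRun : List ℕ → List ℕ × List ℕ
splitFirstRun d = 0 ∷ proj₁ (breakAtZero (tail₀ d)) , proj₂ (breakAtZero (tail₀ d))

breakAtZero-++ : ∀ xs → proj₁ (breakAtZero xs) ++ proj₂ (breakAtZero xs) ≡ xs
breakAtZero-++ [] = refl
breakAtZero-++ (zero ∷ xs) = refl
breakAtZero-++ (suc x ∷ xs) = cong (suc x ∷_) (breakAtZero-++ xs)

EmptyOrZero : List ℕ → Set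
EmptyOrZero w = w ≡ [] ⊎ Σ (List ℕ) λ w' → w ≡ 0 ∷ w'

EmptyOrZero-breakAtZero : ∀ xs → EmptyOrZero (proj₂ (breakAtZero xs))
EmptyOrZero-breakAtZero [] = inj₁ refl
EmptyOrZero-breakAtZero (zero ∷ xs) = inj₂ (xs , refl)
EmptyOrZero-breakAtZero (suc x ∷ xs) = EmptyOrZero-breakAtZero xs

zeros-breakAtZero : ∀ xs → zeros (proj₁ (breakAtZero xs)) ≡ 0
zeros-breakAtZero [] = refl
zeros-breakAtZero (zero ∷ xs) = refl
zeros-breakAtZero (suc x ∷ xs) = zeros-breakAtZero xs

zeros-++ : ∀ xs ys → zeros (xs ++ ys) ≡ zeros xs + zeros ys
zeros-++ [] ys = refl
zeros-++ (zero ∷ xs) ys = cong suc (zeros-++ xs ys)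
zeros-++ (suc x ∷ xs) ys = zeros-++ xs ys

breakAtZero-++⁻ : ∀ u w → zeros u ≡ 0 → EmptyOrZero w → breakAtZero (u ++ w) ≡ (u , w)
breakAtZero-++⁻ [] [] _ _ = refl
breakAtZero-++⁻ [] (.0 ∷ w') _ (inj₂ (_ , refl)) = refl
breakAtZero-++⁻ (suc x ∷ u) w z zw = cong (λ r → suc x ∷ proj₁ r , proj₂ r) (breakAtZero-++⁻ u w z zw)

Catalan-++⁻ : ∀ {p} u w → CatalanAfter p (u ++ w) → EmptyOrZero w → CatalanAfter p u × Catalan w
Catalan-++⁻ [] [] v _ = tt , tt
Catalan-++⁻ [] (.0 ∷ w') (_ , v) (inj₂ (_ , refl)) = tt , (refl , v)
Catalan-++⁻ (x ∷ u) w (le , v) zw = (le , proj₁ (Catalan-++⁻ u w v zw)) , proj₂ (Catalan-++⁻ u w v zw)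

Catalan-++⁺ : ∀ {p} u w → CatalanAfter p u → Catalan w → CatalanAfter p (u ++ w)
Catalan-++⁺ [] [] _ _ = tt
Catalan-++⁺ [] (.0 ∷ w') _ (refl , v) = z≤n , v
Catalan-++⁺ (x ∷ u) w (le , v) vw = le , Catalan-++⁺ u w v vw

Catalan⇒EmptyOrZero : ∀ w → Catalan w → EmptyOrZero w
Catalan⇒EmptyOrZero [] _ = inj₁ refl
Catalan⇒EmptyOrZero (.0 ∷ w') (refl , _) = inj₂ (w' , refl)

firstRun-bijection : ∀ n → Bijection (CatalanOfLength (suc n)) (FirstRunSplit (suc n))
firstRun-bijection n = record { f = splitFirstRun ; g = λ z → proj₁ z ++ proj₂ z ; f-resp = f-resp ; g-resp = g-resp ; g∘f = g∘f ; f∘g = f∘g }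
  where
  f-resp : ∀ {d} → CatalanOfLength (suc n) d → FirstRunSplit (suc n) (splitFirstRun d)
  f-resp {.0 ∷ rest} (l , (refl , v)) =
    suc (length u) , ∈-range⁺ (s≤s z≤n) (s≤s lu≤) ,
    ((refl , (refl , proj₁ vs)) , cong suc (zeros-breakAtZero rest)) ,
    (lw , proj₂ vs)
    where
    u = proj₁ (breakAtZero rest)
    w = proj₂ (breakAtZero rest)
    vs = Catalan-++⁻ u w (subst (CatalanAfter 0) (sym (breakAtZero-++ rest)) v) (EmptyOrZero-breakAtZero rest)
    lsum : length u + length w ≡ n
    lsum = trans (sym (length-++ u)) (trans (cong length (breakAtZero-++ rest)) (suc-injective l))
    lu≤ : length u ≤ n
    lu≤ = ≤-trans (m≤m+n (length u) (length w)) (≤-reflexive lsum)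
    lw : length w ≡ suc n ∸ suc (length u)
    lw = sym (trans (cong (_∸ length u) (sym lsum)) (m+n∸m≡n (length u) (length w)))
  g-resp : ∀ {z} → FirstRunSplit (suc n) z → CatalanOfLength (suc n) (proj₁ z ++ proj₂ z)
  g-resp {(.0 ∷ u) , w} (c , cm , ((lc , (refl , vu)) , z1) , (lw , vw)) =
    trans (length-++ (0 ∷ u)) (trans (cong₂ _+_ lc lw) (m+[n∸m]≡n (proj₂ (∈-range⁻ cm)))) ,
    (refl , Catalan-++⁺ u w vu vw)
  g∘f : ∀ {d} → CatalanOfLength (suc n) d → proj₁ (splitFirstRun d) ++ proj₂ (splitFirstRun d) ≡ d
  g∘f {.0 ∷ rest} (l , (refl , v)) = cong (0 ∷_) (breakAtZero-++ rest)
  f∘g : ∀ {z} → FirstRunSplit (suc n) z → splitFirstRun (proj₁ z ++ proj₂ z) ≡ z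
  f∘g {(.0 ∷ u) , w} (c , cm , ((lc , (refl , vu)) , z1) , (lw , vw)) =
    cong (λ r → 0 ∷ proj₁ r , proj₂ r) (breakAtZero-++⁻ u w (suc-injective z1) (Catalan⇒EmptyOrZero w vw))

zeros-splitFirstRun : ∀ n d → CatalanOfLength (suc n) d → zeros d ≡ suc (zeros (proj₂ (splitFirstRun d)))
zeros-splitFirstRun n (.0 ∷ rest) (l , (refl , v)) =
  cong suc (trans (cong zeros (sym (breakAtZero-++ rest))) (trans (zeros-++ u w) (cong (_+ zeros w) (zeros-breakAtZero rest))))
  where
  u = proj₁ (breakAtZero rest)
  w = proj₂ (breakAtZero rest)

ballotCount : ℕ → ℕ → ℕ
ballotCount a c with c ≤? a
... | yes c≤a = proj₁ (ballot-equinumerous catalanZerosFamily revCatalanHeadFamily c≤a)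
... | no _    = 0

CatalanZeros-card : ∀ a c → HasCard (λ d → c ≤ a × CatalanZeros a c d) (ballotCount a c)
CatalanZeros-card a c with c ≤? a
... | yes c≤a = HasCard-resp-⇔ (λ _ → mk⇔ (c≤a ,_) proj₂)
                  (proj₁ (proj₂ (ballot-equinumerous catalanZerosFamily revCatalanHeadFamily c≤a)))
... | no c≰a  = HasCard-empty (λ _ p → c≰a (proj₁ p))

RevCatalanHead-card : ∀ a c → HasCard (λ r → c ≤ a × RevCatalanHead a c r) (ballotCount a c)
RevCatalanHead-card a c with c ≤? a
... | yes c≤a = HasCard-resp-⇔ (λ _ → mk⇔ (c≤a ,_) proj₂)
                  (proj₂ (proj₂ (ballot-equinumerous catalanZerosFamily revCatalanHeadFamily c≤a)))
... | no c≰a  = HasCard-empty (λ _ p → c≰a (proj₁ p))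

catalanCount : ℕ → ℕ
catalanCount zero    = 1
catalanCount (suc a) = sum (map (ballotCount a) (upTo (suc a)))

RevCatalanOfLength-card : ∀ n → HasCard (RevCatalanOfLength n) (catalanCount n)
RevCatalanOfLength-card zero = HasCard-singleton [] (λ { [] → mk⇔ (λ _ → refl) (λ _ → refl , tt) ; (x ∷ r) → mk⇔ (λ { (() , _) }) (λ ()) })
RevCatalanOfLength-card (suc a) = HasCard-resp-⇔ e (HasCard-⋃ (upTo (suc a)) (UP.upTo⁺ (suc a)) (λ c r → c ≤ a × RevCatalanHead a c r) (ballotCount a) (RevCatalanHead-card a)
   (λ i j r p q → ∸-cancelˡ-≡ (proj₁ p) (proj₁ q) (trans (sym (proj₂ (proj₂ (proj₂ p)))) (proj₂ (proj₂ (proj₂ q))))))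
  where
  e : ∀ r → (∃ λ c → c ∈ upTo (suc a) × (c ≤ a × RevCatalanHead a c r)) ⇔ RevCatalanOfLength (suc a) r
  e r = mk⇔ (λ { (c , _ , _ , (l , v , _)) → l , v }) (to' r)
    where
    to' : ∀ r → RevCatalanOfLength (suc a) r → ∃ λ c → c ∈ upTo (suc a) × (c ≤ a × RevCatalanHead a c r)
    to' (x ∷ r') (l' , v') = a ∸ x , ∈-upTo⁺ (s≤s (m∸n≤m a x)) , m∸n≤m a x ,
          (l' , v' , sym (m∸[m∸n]≡n (≤-trans (RevCatalan-head≤length x r' v') (≤-reflexive (suc-injective l')))))

zeros≥1 : ∀ d → Catalan d → 1 ≤ length d → 1 ≤ zeros d
zeros≥1 (.0 ∷ d) (refl , _) _ = s≤s z≤n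

CatalanOfLength-card : ∀ n → HasCard (CatalanOfLength n) (catalanCount n)
CatalanOfLength-card zero = HasCard-singleton [] (λ { [] → mk⇔ (λ _ → refl) (λ _ → refl , tt) ; (x ∷ r) → mk⇔ (λ { (() , _) }) (λ ()) })
CatalanOfLength-card (suc a) = HasCard-resp-⇔ e (HasCard-⋃ (upTo (suc a)) (UP.upTo⁺ (suc a)) (λ c d → c ≤ a × CatalanZeros a c d) (ballotCount a) (CatalanZeros-card a)
   (λ i j d p q → ∸-cancelˡ-≡ (≤-trans (proj₁ p) (n≤1+n a)) (≤-trans (proj₁ q) (n≤1+n a))
                    (trans (sym (proj₂ (proj₂ (proj₂ p)))) (proj₂ (proj₂ (proj₂ q))))))
  where
  e : ∀ d → (∃ λ c → c ∈ upTo (suc a) × (c ≤ a × CatalanZeros a c d)) ⇔ CatalanOfLength (suc a) d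
  e d = mk⇔ (λ { (c , _ , _ , (l , v , _)) → l , v }) to'
    where
    to' : CatalanOfLength (suc a) d → ∃ λ c → c ∈ upTo (suc a) × (c ≤ a × CatalanZeros a c d)
    to' (l , v) = suc a ∸ zeros d , ∈-upTo⁺ (s≤s c≤a) , c≤a , (l , v , sym (m∸[m∸n]≡n zl))
      where
      z1 : 1 ≤ zeros d
      z1 = zeros≥1 d v (≤-trans (s≤s z≤n) (≤-reflexive (sym l)))
      zl : zeros d ≤ suc a
      zl = ≤-trans (zeros≤length d) (≤-reflexive l)
      c≤a : suc a ∸ zeros d ≤ a
      c≤a = ≤-trans (∸-monoʳ-≤ (suc a) z1) ≤-refl

Av-card : ∀ n → HasCard (Av n) (catalanCount n)
Av-card n = HasCard-resp-Bijection (Bijection-sym (generatingTree n)) (RevCatalanOfLength-card n)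

AvBlocks CatalanZerosOfLength : ℕ → ℕ → List ℕ → Set
AvBlocks n k π = Av n π × bl π ≡ k
CatalanZerosOfLength n k d = CatalanOfLength n d × zeros d ≡ k

avBlocksCount catalanZerosCount : ℕ → ℕ → ℕ
avBlocksCount n k = proj₁ (HasCard-filter (Av-card n) (λ π → bl π ≡ k) (λ π → bl π ≟ k))
catalanZerosCount n k = proj₁ (HasCard-filter (CatalanOfLength-card n) (λ d → zeros d ≡ k) (λ d → zeros d ≟ k))

AvBlocks-card : ∀ n k → HasCard (AvBlocks n k) (avBlocksCount n k)
AvBlocks-card n k = proj₂ (HasCard-filter (Av-card n) (λ π → bl π ≡ k) (λ π → bl π ≟ k))

CatalanZerosOfLength-card : ∀ n k → HasCard (CatalanZerosOfLength n k) (catalanZerosCount n k)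
CatalanZerosOfLength-card n k = proj₂ (HasCard-filter (CatalanOfLength-card n) (λ d → zeros d ≡ k) (λ d → zeros d ≟ k))

Indecomposable-length : ∀ {c c′ β} → Indecomposable c β → Indecomposable c′ β → c ≡ c′
Indecomposable-length p q = trans (sym (IsPerm⇒length (proj₁ (proj₁ p)))) (IsPerm⇒length (proj₁ (proj₁ q)))

PrimeCatalan-length : ∀ {c c′ d} → PrimeCatalan c d → PrimeCatalan c′ d → c ≡ c′
PrimeCatalan-length p q = trans (sym (proj₁ (proj₁ p))) (proj₁ (proj₁ q))

Av-convolution : ∀ n → HasCard (Av (suc n))
  (sum (map (λ c → avBlocksCount c 1 * catalanCount (suc n ∸ c)) (range (suc n))))
Av-convolution n = HasCard-resp-Bijection (Bijection-sym (firstBlock-bijection n))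
  (HasCard-Convolution (suc n) (λ c → AvBlocks-card c 1) (λ c → Av-card (suc n ∸ c)) Indecomposable-length)

Catalan-convolution : ∀ n → HasCard (CatalanOfLength (suc n))
  (sum (map (λ c → catalanZerosCount c 1 * catalanCount (suc n ∸ c)) (range (suc n))))
Catalan-convolution n = HasCard-resp-Bijection (Bijection-sym (firstRun-bijection n))
  (HasCard-Convolution (suc n) (λ c → CatalanZerosOfLength-card c 1) (λ c → CatalanOfLength-card (suc n ∸ c))
    PrimeCatalan-length)

AvBlocks-convolution : ∀ n k → HasCard (AvBlocks (suc n) (suc k))
  (sum (map (λ c → avBlocksCount c 1 * avBlocksCount (suc n ∸ c) k) (range (suc n))))
AvBlocks-convolution n k =
  HasCard-resp-Bijection (Bijection-sym (Bijection-restrict (firstBlock-bijection n) bl (bl ∘ proj₂) (bl-splitFirstBlock n _) k))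
    (HasCard-resp-⇔ Convolution-×
      (HasCard-Convolution (suc n) (λ c → AvBlocks-card c 1) (λ c → AvBlocks-card (suc n ∸ c) k) Indecomposable-length))

CatalanZeros-convolution : ∀ n k → HasCard (CatalanZerosOfLength (suc n) (suc k))
  (sum (map (λ c → catalanZerosCount c 1 * catalanZerosCount (suc n ∸ c) k) (range (suc n))))
CatalanZeros-convolution n k =
  HasCard-resp-Bijection (Bijection-sym (Bijection-restrict (firstRun-bijection n) zeros (zeros ∘ proj₂) (zeros-splitFirstRun n _) k))
    (HasCard-resp-⇔ Convolution-×
      (HasCard-Convolution (suc n) (λ c → CatalanZerosOfLength-card c 1) (λ c → CatalanZerosOfLength-card (suc n ∸ c) k)
        PrimeCatalan-length))

sum-map-cong : ∀ {f g : ℕ → ℕ} xs → (∀ x → x ∈ xs → f x ≡ g x) → sum (map f xs) ≡ sum (map g xs)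
sum-map-cong xs f≗g = cong sum (map-cong-local (All.tabulate (λ {x} x∈xs → f≗g x x∈xs)))

sum-map-range-suc : ∀ (f : ℕ → ℕ) n → sum (map f (range (suc n))) ≡ sum (map f (range n)) + f (suc n)
sum-map-range-suc f n = begin
  sum (map f (range (suc n)))             ≡⟨ cong (sum ∘ map f) (range-suc n) ⟩
  sum (map f (range n ++ [ suc n ]))      ≡⟨ cong sum (map-++ f (range n) [ suc n ]) ⟩
  sum (map f (range n) ++ [ f (suc n) ])  ≡⟨ sum-++ (map f (range n)) [ f (suc n) ] ⟩
  sum (map f (range n)) + (f (suc n) + 0) ≡⟨ cong (sum (map f (range n)) +_) (+-identityʳ (f (suc n))) ⟩
  sum (map f (range n)) + f (suc n)       ∎
  where open ≡-Reasoning

CountsAgree : ℕ → Set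
CountsAgree n = ∀ k → avBlocksCount n k ≡ catalanZerosCount n k

counts-agree-0 : CountsAgree 0
counts-agree-0 k = HasCard-unique (HasCard-resp-⇔ onlyEmptyPerm (AvBlocks-card 0 k))
                                  (HasCard-resp-⇔ onlyEmptySeq (CatalanZerosOfLength-card 0 k))
  where
  onlyEmptyPerm : ∀ π → AvBlocks 0 k π ⇔ (π ≡ [] × 0 ≡ k)
  onlyEmptyPerm π = mk⇔ (λ { ((p , _) , b) → let π≡[] = length≡0⇒[] (IsPerm⇒length p) in π≡[] , trans (sym (cong bl π≡[])) b })
                        (λ { (refl , refl) → (↭-refl , Avoids321-[]) , refl })
  onlyEmptySeq : ∀ d → CatalanZerosOfLength 0 k d ⇔ (d ≡ [] × 0 ≡ k)
  onlyEmptySeq d = mk⇔ (λ { ((l , _) , z) → let d≡[] = length≡0⇒[] l in d≡[] , trans (sym (cong zeros d≡[])) z })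
                       (λ { (refl , refl) → (refl , tt) , refl })

-- Both totals are Catalan numbers and every term but the last of the two
-- first-block expansions agrees by induction; the last term is the count of
-- indecomposables times catalanCount 0 = 1.
indecomposables-agree : ∀ n → (∀ {m} → m < suc n → CountsAgree m) →
                        avBlocksCount (suc n) 1 ≡ catalanZerosCount (suc n) 1
indecomposables-agree n IH = *-cancelʳ-≡ _ _ 1 (begin
  avBlocksCount N 1 * 1                  ≡⟨ cong (λ w → avBlocksCount N 1 * catalanCount w) (sym (n∸n≡0 N)) ⟩
  F N                                    ≡⟨ +-cancelˡ-≡ (sum (map F (range n))) (F N) (G N) lastTerms ⟩
  G N                                    ≡⟨ cong (λ w → catalanZerosCount N 1 * catalanCount w) (n∸n≡0 N) ⟩
  catalanZerosCount N 1 * 1              ∎)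
  where
  open ≡-Reasoning
  N = suc n
  F G : ℕ → ℕ
  F c = avBlocksCount c 1 * catalanCount (N ∸ c)
  G c = catalanZerosCount c 1 * catalanCount (N ∸ c)
  lastTerms : sum (map F (range n)) + F N ≡ sum (map F (range n)) + G N
  lastTerms = begin
    sum (map F (range n)) + F N  ≡⟨ sym (sum-map-range-suc F n) ⟩
    sum (map F (range N))        ≡⟨ HasCard-unique (Av-convolution n) (Av-card N) ⟩
    catalanCount N               ≡⟨ HasCard-unique (CatalanOfLength-card N) (Catalan-convolution n) ⟩
    sum (map G (range N))        ≡⟨ sum-map-range-suc G n ⟩
    sum (map G (range n)) + G N  ≡⟨ cong (_+ G N) (sum-map-cong (range n) (λ c c∈ →
                                      cong (_* catalanCount (N ∸ c)) (sym (IH (s≤s (proj₂ (∈-range⁻ c∈))) 1)))) ⟩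
    sum (map F (range n)) + G N  ∎

counts-agree-suc : ∀ n → (∀ {m} → m < suc n → CountsAgree m) → CountsAgree (suc n)
counts-agree-suc n IH zero = trans (HasCard-unique (AvBlocks-card N 0) (HasCard-empty noPerm))
                                   (HasCard-unique (HasCard-empty noSeq) (CatalanZerosOfLength-card N 0))
  where
  N = suc n
  noPerm : ∀ π → ¬ AvBlocks N 0 π
  noPerm π (s , b) = 0≢1+n (trans (sym b) (bl-splitFirstBlock n π s))
  noSeq : ∀ d → ¬ CatalanZerosOfLength N 0 d
  noSeq d (s , z) = 0≢1+n (trans (sym z) (zeros-splitFirstRun n d s))
counts-agree-suc n IH (suc k) = begin
  avBlocksCount N (suc k)
    ≡⟨ HasCard-unique (AvBlocks-card N (suc k)) (AvBlocks-convolution n k) ⟩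
  sum (map (λ c → avBlocksCount c 1 * avBlocksCount (N ∸ c) k) (range N))
    ≡⟨ sum-map-cong (range N) term ⟩
  sum (map (λ c → catalanZerosCount c 1 * catalanZerosCount (N ∸ c) k) (range N))
    ≡⟨ HasCard-unique (CatalanZeros-convolution n k) (CatalanZerosOfLength-card N (suc k)) ⟩
  catalanZerosCount N (suc k) ∎
  where
  open ≡-Reasoning
  N = suc n
  term : ∀ c → c ∈ range N → avBlocksCount c 1 * avBlocksCount (N ∸ c) k ≡ catalanZerosCount c 1 * catalanZerosCount (N ∸ c) k
  term c c∈ with ∈-range⁻ c∈
  ... | 1≤c , c≤N with m≤n⇒m<n∨m≡n c≤N
  ...   | inj₁ c<N  = cong₂ _*_ (IH c<N 1) (IH (∸-monoʳ-< 1≤c c≤N) k)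
  ...   | inj₂ refl = cong₂ _*_ (indecomposables-agree n IH) (IH (subst (_< N) (sym (n∸n≡0 N)) (s≤s z≤n)) k)

counts-agree : ∀ n → CountsAgree n
counts-agree = <-rec CountsAgree step
  where
  step : ∀ n → (∀ {m} → m < n → CountsAgree m) → CountsAgree n
  step zero    _  = counts-agree-0
  step (suc n) IH = counts-agree-suc n IH

AvBlocks-card-from-zeros : ∀ {n k m} → HasCard (CatalanZerosOfLength n k) m → HasCard (AvBlocks n k) m
AvBlocks-card-from-zeros {n} {k} h =
  subst (HasCard (AvBlocks n k)) (trans (counts-agree n k) (HasCard-unique (CatalanZerosOfLength-card n k) h)) (AvBlocks-card n k)

ldes-bijection : ∀ n v → v ≤ n ∸ 1 →
                 Bijection (λ π → Av n π × ldes π ≡ v) (λ r → RevCatalanOfLength n r × head₀ r ≡ n ∸ 1 ∸ v)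
ldes-bijection n v v≤ = record
  { f = encode n ; g = decode
  ; f-resp = λ { {π} (s , e) → f-resp s , trans (head-encode n π s) (cong (n ∸ 1 ∸_) e) }
  ; g-resp = λ { {r} (q , e) → g-resp q , ∸-cancelˡ-≡ (ldes-bound q) v≤
                 (trans (sym (head-encode n (decode r) (g-resp q))) (trans (cong head₀ (f∘g q)) e)) }
  ; g∘f = λ { (s , _) → g∘f s } ; f∘g = λ { (q , _) → f∘g q } }
  where
  open Bijection (generatingTree n)
  ldes-bound : ∀ {r} → RevCatalanOfLength n r → ldes (decode r) ≤ n ∸ 1
  ldes-bound {r} q = ≤-trans (ldes≤length∸1 (decode r)) (≤-reflexive (cong (_∸ 1) (IsPerm⇒length (proj₁ (g-resp {r} q)))))

Av-ldes-inv-card : ∀ {a c m} → c ≤ a → HasCard (RevCatalanHead a c) m →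
                    HasCard (λ π → Av (suc a) π × ldes (inv π) ≡ c) m
Av-ldes-inv-card {a} {c} c≤a h =
  HasCard-resp-Bijection (Bijection-sym (inv-bijection (suc a) c))
    (HasCard-resp-Bijection (Bijection-sym (ldes-bijection (suc a) c c≤a))
      (HasCard-resp-⇔ (λ _ → mk⇔ assocˡ′ assocʳ′) h))

zeros-complement : ∀ {a k} → k ≤ a → suc a ∸ (a ∸ k) ≡ suc k
zeros-complement {a} {k} k≤a = trans (+-∸-assoc 1 (m∸n≤m a k)) (cong suc (m∸[m∸n]≡n k≤a))

corollary3p5 : (n k : ℕ) → 1 ≤ k → k ≤ n →
    ∃[ m ] (HasCard (λ π → IsPerm n π × Avoids321 π × bl π ≡ k) m
    × HasCard (λ π → IsPerm n π × Avoids321 π × ldes (inv π) ≡ n ∸ k) m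
    × HasCard (IsSYT (n ∸ 1 ∷ n ∸ k ∷ [])) m)
corollary3p5 zero (suc k) _ ()
corollary3p5 (suc a) (suc k) _ (s≤s k≤a)
  with ballot-equinumerous sytFamily catalanZerosFamily (m∸n≤m a k)
... | m , tableaux , sequences =
  m , HasCard-resp-⇔ (λ _ → mk⇔ assocʳ′ assocˡ′) blocks
    , HasCard-resp-⇔ (λ _ → mk⇔ assocʳ′ assocˡ′) (Av-ldes-inv-card (m∸n≤m a k) headSequences)
    , tableaux
  where
  blocks : HasCard (AvBlocks (suc a) (suc k)) m
  blocks = AvBlocks-card-from-zeros (subst (λ z → HasCard (CatalanZerosOfLength (suc a) z) m) (zeros-complement k≤a)
             (HasCard-resp-⇔ (λ _ → mk⇔ assocˡ′ assocʳ′) sequences))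
  headSequences : HasCard (RevCatalanHead a (a ∸ k)) m
  headSequences = ballot-transfer sytFamily revCatalanHeadFamily (m∸n≤m a k) tableaux
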